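{- Let $\hat{\boldsymbol{\phi}}=(\phi_i^{[L]})_{i\ge0,\,L\ge1}$ be indeterminates and work in $\mathbb{Z}[\hat{\boldsymbol{\phi}}]$. Define lower-Hessenberg matrices $P^{\mathrm{ord}}=(p^{\mathrm{ord}}_{ij})$, $P=(p_{ij})$, $\tilde P=(\tilde p_{ij})$ ($i,j\ge0$) by: all three vanish when $j=0$ or $j>i+1$; for $1\le j\le i+1$, $p^{\mathrm{ord}}_{ij}=j\,\phi^{[j]}_{i-j+1}$ and $p_{ij}=\frac{i!}{(j-1)!}\phi^{[j]}_{i-j+1}$; for $1\le j\le i$, $\tilde p_{ij}=\frac{i!}{(j-1)!}\,\phi_0^{[j+1]}\cdots\phi_0^{[i]}\,\phi^{[j]}_{i-j+1}$, and $\tilde p_{i,i+1}=1$. Then: (a) $P^{\mathrm{ord}}$ is the production matrix for $(k!\,\hat L_{n,k}(\hat{\boldsymbol{\phi}}))_{n,k\ge0}$. (b) $P$ is the production matrix for $(\hat L_{n,k}(\hat{\boldsymbol{\phi}}))_{n,k\ge0}$. (c) $\tilde P$ is the production matrix for $\big(\hat L_{n,k}(\hat{\boldsymbol{\phi}})/(\phi_0^{[1]}\phi_0^{[2]}\cdots\phi_0^{[k]})\big)_{n,k\ge0}$.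
   Context: Level of a vertex: let $F$ be a forest of increasing trees on a totally ordered vertex set, with $k$ trees. For a vertex $j$, let $r_j$ be the number of trees of $F$ containing at least one vertex $\le j$. The level of $j$ in $F$ is the number of children of vertices $<j$ whose labels are $>j$, plus $k+1-r_j$. An ordered tree is a rooted tree in which the children of each vertex are linearly ordered; an increasing ordered tree on a finite set of integers is an ordered tree bijectively labeled by that set so that every child has larger label than its parent. $\hat L_{n,k}(\hat{\boldsymbol{\phi}})$ is the sum over all unordered forests of $k$ increasing ordered trees whose vertex sets partition $[n]$ of the product over vertices of $\phi_i^{[L]}$, where $i$ is the number of children and $L$ the level of the vertex ($\hat L_{0,0}=1$, $\hat L_{0,k}=0$ for $k\ge1$, $\hat L_{n,0}=0$ for $n\ge1$). The quotients in (c) are taken in $\mathbb{Z}[\hat{\boldsymbol{\phi}},\hat{\boldsymbol{\phi}}^{ -1}]$. For a row-finite or column-finite matrix $P$, the output matrix is $\mathcal{O}(P)=((P^n)_{0k})_{n,k\ge0}$; "$P$ is the production matrix for $A$" means $A=\mathcal{O}(P)$. -}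

module Defs where

open import Level using (Level)
open import Algebra.Bundles using (CommutativeRing)
open import Data.Nat using (ℕ; zero; suc; _+_; _∸_; _<_; _≤ᵇ_; _<ᵇ_; _≡ᵇ_; _!)
open import Data.Nat.Combinatorics using (_P_)
open import Data.Bool using (Bool; true; false; if_then_else_; _∧_)
open import Data.Product using (_×_; _,_; proj₁; proj₂)
open import Relation.Binary.PropositionalEquality using (_≡_)
open import Data.Bool.ListAction using (any)
open import Data.List using (List; []; _∷_; _++_; map; length; filterᵇ; applyUpTo; upTo; foldr)
open import Data.List.Membership.Propositional using (_∈_)
open import Data.List.Relation.Unary.All using (All)
open import Data.List.Relation.Unary.Linked using (Linked)
open import Data.List.Relation.Unary.Unique.Propositional using (Unique)
open import Data.List.Relation.Binary.Permutation.Propositional using (_↭_)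

data Tree : Set where
  node : ℕ → List Tree → Tree

root : Tree → ℕ
root (node v _) = v

mutual
  labels : Tree → List ℕ
  labels (node v ts) = v ∷ labelsF ts

  labelsF : List Tree → List ℕ
  labelsF []       = []
  labelsF (t ∷ ts) = labels t ++ labelsF ts

mutual
  edges : Tree → List (ℕ × ℕ)
  edges (node v ts) = map (λ t → v , root t) ts ++ edgesF ts

  edgesF : List Tree → List (ℕ × ℕ)
  edgesF []       = []
  edgesF (t ∷ ts) = edges t ++ edgesF ts

mutual
  verts : Tree → List (ℕ × ℕ)
  verts (node v ts) = (v , length ts) ∷ vertsF ts

  vertsF : List Tree → List (ℕ × ℕ)
  vertsF []       = []
  vertsF (t ∷ ts) = verts t ++ vertsF ts

IncreasingTree : Tree → Set
IncreasingTree t = All (λ e → proj₁ e < proj₂ e) (edges t)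

-- A forest is represented as a list of trees; an *unordered* forest is
-- represented canonically by listing its trees in increasing order of roots.
Forest : Set
Forest = List Tree

ValidForest : ℕ → ℕ → Forest → Set
ValidForest n k F =
  (length F ≡ k) × Linked _<_ (map root F) × All IncreasingTree F
  × (labelsF F ↭ applyUpTo suc n)

IsForestEnum : ℕ → ℕ → List Forest → Set
IsForestEnum n k fs =
  (∀ F → F ∈ fs → ValidForest n k F) × (∀ F → ValidForest n k F → F ∈ fs) × Unique fs

level : Forest → ℕ → ℕ
level F j =
  length (filterᵇ (λ e → (proj₁ e <ᵇ j) ∧ (j <ᵇ proj₂ e)) (edgesF F))
  + (suc (length F) ∸ r)
  where
    r = length (filterᵇ (λ t → any (λ v → v ≤ᵇ j) (labels t)) F)

module _ {c ℓ : Level} (R : CommutativeRing c ℓ) where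
  open CommutativeRing R using (Carrier; 0#; 1#) renaming (_+_ to _+R_; _*_ to _*R_)

  fromℕ : ℕ → Carrier
  fromℕ zero    = 0#
  fromℕ (suc n) = 1# +R fromℕ n

  prodR : List Carrier → Carrier
  prodR = foldr _*R_ 1#

  sumR : List Carrier → Carrier
  sumR = foldr _+R_ 0#

  -- φ i L stands for φ_i^{[L]}
  -- weight of a forest: ∏ over vertices v of φ_{#children(v)}^{[level(v)]}
  weight : (ℕ → ℕ → Carrier) → Forest → Carrier
  weight φ F = prodR (map (λ vc → φ (proj₂ vc) (level F (proj₁ vc))) (vertsF F))

  Lhat : (ℕ → ℕ → Carrier) → List Forest → Carrier
  Lhat φ fs = sumR (map (weight φ) fs)

  prodPhi0 : (ℕ → ℕ → Carrier) → ℕ → ℕ → Carrier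
  prodPhi0 φ a m = prodR (applyUpTo (λ t → φ 0 (a + t)) m)

  -- Matrices indexed by ℕ × ℕ.
  -- (P^m)_{ik} for a row-finite matrix P with P i j = 0 whenever j ≥ b i.
  matPow : (ℕ → ℕ → Carrier) → (ℕ → ℕ) → ℕ → ℕ → ℕ → Carrier
  matPow M b zero    i k = if i ≡ᵇ k then 1# else 0#
  matPow M b (suc m) i k = sumR (applyUpTo (λ j → M i j *R matPow M b m j k) (b i))

  output : (ℕ → ℕ → Carrier) → (ℕ → ℕ) → ℕ → ℕ → Carrier
  output M b n k = matPow M b n 0 k

  -- row bound for lower-Hessenberg matrices: P i j = 0 for j > i + 1
  hessBound : ℕ → ℕ
  hessBound i = suc (suc i)

  Pord : (ℕ → ℕ → Carrier) → ℕ → ℕ → Carrier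
  Pord φ i zero    = 0#
  Pord φ i (suc j) = if j ≤ᵇ i then fromℕ (suc j) *R φ (i ∸ j) (suc j) else 0#

  -- p_{ij} = i!/(j-1)! φ_{i-j+1}^{[j]} for 1 ≤ j ≤ i+1, else 0
  -- (i!/(j-1)! = i P (i-j+1), the falling factorial)
  Pmat : (ℕ → ℕ → Carrier) → ℕ → ℕ → Carrier
  Pmat φ i zero    = 0#
  Pmat φ i (suc j) = if j ≤ᵇ i then fromℕ (i P (i ∸ j)) *R φ (i ∸ j) (suc j) else 0#

  Ptil : (ℕ → ℕ → Carrier) → ℕ → ℕ → Carrier
  Ptil φ i zero    = 0#
  Ptil φ i (suc j) =
    if j <ᵇ i
      then fromℕ (i P (i ∸ j)) *R prodPhi0 φ (suc (suc j)) (i ∸ suc j) *R φ (i ∸ j) (suc j)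
      else (if j ≡ᵇ i then 1# else 0#)

module Submission where

-- The heart is (b). In a forest on {a+1, …, a+n+1} the smallest vertex a+1
-- is the root of the first tree. Deleting it leaves a forest G on
-- {a+2, …, a+n+1} whose trees are the children s of a+1 (in order) and the
-- remaining trees r. This is a bijection between forests with k trees and
-- pairs (G, ordered selection s of trees of G with |r| = k − 1); it
-- multiplies the weight by φ_{|s|}^{[k]} and keeps every other level. Since
-- j trees admit j!/(k−1)! such selections, L̂_{n+1,k} = Σ_j L̂_{n,j} P_{jk},
-- i.e. L̂ is the output matrix of P. Parts (a) and (c) follow because P^ord
-- and P̃ are diagonally similar to P, via diag(k!) and diag(φ₀^{[1]} ⋯ φ₀^{[k]}).

open import Defs
open import Level using (Level)
open import Algebra.Bundles using (CommutativeRing)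
open import Data.Nat as ℕ using (ℕ; zero; suc; _+_; _*_; _∸_; _≤_; _<_; z≤n; s≤s; _≤ᵇ_; _<ᵇ_; _≡ᵇ_; _!)
import Data.Nat.Properties as ℕ
open import Data.Nat.Solver using (module +-*-Solver)
open import Data.Nat.Combinatorics.Base using (_P_; _P′_)
open import Data.Nat.Combinatorics.Specification using (nP′k≡n[n∸1P′k∸1])
open import Algebra.Properties.CommutativeSemigroup ℕ.*-commutativeSemigroup using (x∙yz≈y∙xz)
open import Data.Bool using (Bool; true; false; if_then_else_; _∧_; _∨_; not)
open import Data.Bool.ListAction using (any)
open import Data.Empty using (⊥; ⊥-elim)
open import Data.Product using (∃; _×_; _,_; proj₁; proj₂)
open import Data.Sum using (_⊎_; inj₁; inj₂)
open import Function using (_∘_)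
open import Function.Bundles using (mk⇔)
open import Data.List using (List; []; _∷_; _++_; map; length; concatMap; filterᵇ; applyUpTo)
open import Data.List.Properties
  using (++-assoc; map-++; map-∘; map-cong-local; length-map; length-++; length-++-≤ˡ; length-++-≤ʳ; filter-++; length-filter)
open import Data.List.Relation.Unary.Any using (here; there)
open import Data.List.Relation.Unary.All as All using (All; []; _∷_)
import Data.List.Relation.Unary.All.Properties as All
open import Data.List.Relation.Unary.AllPairs using (AllPairs; []; _∷_)
open import Data.List.Relation.Unary.Linked using (Linked)
import Data.List.Relation.Unary.Linked.Properties as Linked
open import Data.List.Relation.Unary.Unique.Propositional using (Unique)
import Data.List.Relation.Unary.Unique.Propositional.Properties as Unique
open import Data.List.Membership.Propositional using (_∈_; find; lose)
open import Data.List.Membership.Propositional.Properties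
  using (∈-map⁺; ∈-map⁻; ∈-++⁺ˡ; ∈-++⁺ʳ; ∈-concatMap⁺; ∈-concatMap⁻; ∈-filter⁺; ∈-filter⁻)
open import Data.List.Membership.Propositional.Properties.WithK using (unique∧set⇒bag)
open import Data.List.Relation.Binary.Permutation.Propositional as ↭
  using (_↭_; prep; swap; ↭-refl; ↭-sym; ↭-trans; ↭-reflexive; ↭⇒↭ₛ; ↭⇒↭ₛ′)
import Data.List.Relation.Binary.Permutation.Propositional.Properties as ↭
open import Data.List.Relation.Binary.Permutation.Propositional.Properties
  using (∈-resp-↭; All-resp-↭; ↭-length; drop-∷; ++⁺ˡ; shifts; filter-↭)
import Data.List.Relation.Binary.Permutation.Setoid.Properties as PermSetoid
open import Data.List.Relation.Binary.BagAndSetEquality using (∼bag⇒↭)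
import Relation.Binary.PropositionalEquality as ≡
open import Relation.Binary.PropositionalEquality
  using (_≡_; _≢_; refl; sym; trans; cong; cong₂; subst; subst₂; module ≡-Reasoning)
open import Relation.Binary.Definitions using (tri<; tri≈; tri>)
open import Relation.Nullary using (¬_; yes; no)
open import Relation.Nullary.Decidable using (T?)
open import Relation.Nullary.Reflects using (Reflects; ofʸ; ofⁿ; det; invert; fromEquivalence)

module _ {A : Set} where

  unique-same-members⇒↭ : {xs ys : List A} → Unique xs → Unique ys →
    (∀ {z} → z ∈ xs → z ∈ ys) → (∀ {z} → z ∈ ys → z ∈ xs) → xs ↭ ys
  unique-same-members⇒↭ ux uy to from = ∼bag⇒↭ (unique∧set⇒bag ux uy (mk⇔ to from))

  unique-resp-↭ : {xs ys : List A} → xs ↭ ys → Unique xs → Unique ys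
  unique-resp-↭ p = PermSetoid.Unique-resp-↭ (≡.setoid A) (↭⇒↭ₛ p)

module _ {A B : Set} (f : A → List B) where

  unique-concatMap : (xs : List A) → Unique xs → (∀ {x} → x ∈ xs → Unique (f x)) →
    (∀ {x y z} → x ∈ xs → y ∈ xs → z ∈ f x → z ∈ f y → x ≡ y) →
    Unique (concatMap f xs)
  unique-concatMap [] _ _ _ = []
  unique-concatMap (x ∷ xs) (x∉xs ∷ uxs) ublock disj =
    Unique.++⁺ (ublock (here refl))
      (unique-concatMap xs uxs (λ m → ublock (there m)) (λ m m′ → disj (there m) (there m′)))
      apart
    where
    apart : ∀ {z} → ¬ (z ∈ f x × z ∈ concatMap f xs)
    apart (zx , zrest) with find (∈-concatMap⁻ f zrest)
    ... | y , y∈xs , zy = All.lookup x∉xs y∈xs (disj (here refl) (there y∈xs) zx zy)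

  ∈-concatMap : ∀ {xs x z} → x ∈ xs → z ∈ f x → z ∈ concatMap f xs
  ∈-concatMap x∈xs z∈fx = ∈-concatMap⁺ f (lose x∈xs z∈fx)

  concatMap-↭ : {xs ys : List A} → xs ↭ ys → concatMap f xs ↭ concatMap f ys
  concatMap-↭ ↭.refl = ↭.refl
  concatMap-↭ (prep x p) = ++⁺ˡ (f x) (concatMap-↭ p)
  concatMap-↭ (swap x y p) = ↭-trans (shifts (f x) (f y)) (++⁺ˡ (f y) (++⁺ˡ (f x) (concatMap-↭ p)))
  concatMap-↭ (↭.trans p q) = ↭-trans (concatMap-↭ p) (concatMap-↭ q)

module _ {A : Set} {b : Bool} (r : Reflects A b) where
  reflects-true : A → b ≡ true
  reflects-true a = det r (ofʸ a)

  reflects-false : ¬ A → b ≡ false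
  reflects-false ¬a = det r (ofⁿ ¬a)

  reflected : b ≡ true → A
  reflected refl = invert r

  not-reflected : b ≡ false → ¬ A
  not-reflected refl = invert r

≡ᵇ-reflects-≡ : ∀ m n → Reflects (m ≡ n) (m ≡ᵇ n)
≡ᵇ-reflects-≡ m n = fromEquivalence (ℕ.≡ᵇ⇒≡ m n) (ℕ.≡⇒≡ᵇ m n)

labelsF≡concatMap : ∀ ts → labelsF ts ≡ concatMap labels ts
labelsF≡concatMap [] = refl
labelsF≡concatMap (t ∷ ts) = cong (labels t ++_) (labelsF≡concatMap ts)

edgesF≡concatMap : ∀ ts → edgesF ts ≡ concatMap edges ts
edgesF≡concatMap [] = refl
edgesF≡concatMap (t ∷ ts) = cong (edges t ++_) (edgesF≡concatMap ts)

vertsF≡concatMap : ∀ ts → vertsF ts ≡ concatMap verts ts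
vertsF≡concatMap [] = refl
vertsF≡concatMap (t ∷ ts) = cong (verts t ++_) (vertsF≡concatMap ts)

labelsF-↭ : ∀ {ts us} → ts ↭ us → labelsF ts ↭ labelsF us
labelsF-↭ {ts} {us} p = subst₂ _↭_ (sym (labelsF≡concatMap ts)) (sym (labelsF≡concatMap us)) (concatMap-↭ labels p)

edgesF-↭ : ∀ {ts us} → ts ↭ us → edgesF ts ↭ edgesF us
edgesF-↭ {ts} {us} p = subst₂ _↭_ (sym (edgesF≡concatMap ts)) (sym (edgesF≡concatMap us)) (concatMap-↭ edges p)

vertsF-↭ : ∀ {ts us} → ts ↭ us → vertsF ts ↭ vertsF us
vertsF-↭ {ts} {us} p = subst₂ _↭_ (sym (vertsF≡concatMap ts)) (sym (vertsF≡concatMap us)) (concatMap-↭ verts p)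

labelsF-++ : ∀ ts us → labelsF (ts ++ us) ≡ labelsF ts ++ labelsF us
labelsF-++ [] us = refl
labelsF-++ (t ∷ ts) us = trans (cong (labels t ++_) (labelsF-++ ts us)) (sym (++-assoc (labels t) _ _))

edgesF-++ : ∀ ts us → edgesF (ts ++ us) ≡ edgesF ts ++ edgesF us
edgesF-++ [] us = refl
edgesF-++ (t ∷ ts) us = trans (cong (edges t ++_) (edgesF-++ ts us)) (sym (++-assoc (edges t) _ _))

vertsF-++ : ∀ ts us → vertsF (ts ++ us) ≡ vertsF ts ++ vertsF us
vertsF-++ [] us = refl
vertsF-++ (t ∷ ts) us = trans (cong (verts t ++_) (vertsF-++ ts us)) (sym (++-assoc (verts t) _ _))

mutual
  verts-labels : ∀ t → map proj₁ (verts t) ≡ labels t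
  verts-labels (node v ts) = cong (v ∷_) (vertsF-labels ts)

  vertsF-labels : ∀ ts → map proj₁ (vertsF ts) ≡ labelsF ts
  vertsF-labels [] = refl
  vertsF-labels (t ∷ ts) = trans (map-++ proj₁ (verts t) (vertsF ts)) (cong₂ _++_ (verts-labels t) (vertsF-labels ts))

vertex∈labelsF : ∀ ts {vc} → vc ∈ vertsF ts → proj₁ vc ∈ labelsF ts
vertex∈labelsF ts m = subst (_ ∈_) (vertsF-labels ts) (∈-map⁺ proj₁ m)

label∈labelsF : ∀ {t ts x} → t ∈ ts → x ∈ labels t → x ∈ labelsF ts
label∈labelsF {ts = _ ∷ ts} (here refl) m = ∈-++⁺ˡ m
label∈labelsF {ts = u ∷ ts} (there t∈ts) m = ∈-++⁺ʳ (labels u) (label∈labelsF t∈ts m)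

root∈labelsF : ∀ {t ts} → t ∈ ts → root t ∈ labelsF ts
root∈labelsF {node v cs} t∈ts = label∈labelsF t∈ts (here refl)

length≤#labels : ∀ ts → length ts ≤ length (labelsF ts)
length≤#labels [] = z≤n
length≤#labels (node v cs ∷ ts) = s≤s (ℕ.≤-trans (length≤#labels ts) (length-++-≤ʳ (labelsF ts) {labelsF cs}))

mutual
  edges-parents : ∀ {Q : ℕ → Set} t → All Q (labels t) → All (Q ∘ proj₁) (edges t)
  edges-parents (node v ts) (pv ∷ pts) = All.++⁺ (All.map⁺ (All.tabulate (λ _ → pv))) (edgesF-parents ts pts)

  edgesF-parents : ∀ {Q : ℕ → Set} ts → All Q (labelsF ts) → All (Q ∘ proj₁) (edgesF ts)
  edgesF-parents [] _ = []
  edgesF-parents (t ∷ ts) a = All.++⁺ (edges-parents t (All.++⁻ˡ (labels t) a)) (edgesF-parents ts (All.++⁻ʳ (labels t) a))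

IncreasingEdge : ℕ × ℕ → Set
IncreasingEdge e = proj₁ e < proj₂ e

increasingF⁻ : ∀ ts → All IncreasingEdge (edgesF ts) → All IncreasingTree ts
increasingF⁻ [] _ = []
increasingF⁻ (t ∷ ts) a = All.++⁻ˡ (edges t) a ∷ increasingF⁻ ts (All.++⁻ʳ (edges t) a)

increasingF⁺ : ∀ ts → All IncreasingTree ts → All IncreasingEdge (edgesF ts)
increasingF⁺ [] _ = []
increasingF⁺ (t ∷ ts) (it ∷ its) = All.++⁺ it (increasingF⁺ ts its)

increasing-node⁻ : ∀ {v ts} → IncreasingTree (node v ts) → All IncreasingTree ts × All (λ t → v < root t) ts
increasing-node⁻ {v} {ts} it =
  increasingF⁻ ts (All.++⁻ʳ (map (λ t → v , root t) ts) it) , All.map⁻ (All.++⁻ˡ (map (λ t → v , root t) ts) it)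

increasing-node⁺ : ∀ {v ts} → All IncreasingTree ts → All (λ t → v < root t) ts → IncreasingTree (node v ts)
increasing-node⁺ {v} {ts} its roots = All.++⁺ (All.map⁺ roots) (increasingF⁺ ts its)

mutual
  root-minimal : ∀ t → IncreasingTree t → All (root t ≤_) (labels t)
  root-minimal (node v ts) it with increasing-node⁻ it
  ... | its , roots = ℕ.≤-refl ∷ All.map ℕ.<⇒≤ (above-parent v ts roots its)

  above-parent : ∀ v ts → All (λ t → v < root t) ts → All IncreasingTree ts → All (v <_) (labelsF ts)
  above-parent v [] _ _ = []
  above-parent v (t ∷ ts) (lt ∷ lts) (it ∷ its) =
    All.++⁺ (All.map (ℕ.<-≤-trans lt) (root-minimal t it)) (above-parent v ts lts its)

none≤ : ∀ {v} xs → All (v <_) xs → any (_≤ᵇ v) xs ≡ false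
none≤ [] _ = refl
none≤ {v} (x ∷ xs) (v<x ∷ vs<xs) rewrite reflects-false (ℕ.≤ᵇ-reflects-≤ x v) (ℕ.<⇒≱ v<x) = none≤ xs vs<xs

any≤-increasing : ∀ t v → IncreasingTree t → any (_≤ᵇ v) (labels t) ≡ (root t ≤ᵇ v)
any≤-increasing (node x ts) v it with x ≤ᵇ v in x≤ᵇv | root-minimal (node x ts) it
... | true  | _ = refl
... | false | _ ∷ x≤ts = none≤ (labelsF ts) (All.map (ℕ.<-≤-trans v<x) x≤ts)
  where
  v<x : v < x
  v<x = ℕ.≰⇒> (not-reflected (ℕ.≤ᵇ-reflects-≤ x v) x≤ᵇv)

Sorted : List Tree → Set
Sorted = AllPairs (λ t u → root t < root u)

sorted⇒unique : ∀ {G} → Sorted G → Unique G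
sorted⇒unique [] = []
sorted⇒unique (below ∷ s) = All.map (λ lt eq → ℕ.<-irrefl (cong root eq) lt) below ∷ sorted⇒unique s

sorted-↭⇒≡ : ∀ {xs ys} → Sorted xs → Sorted ys → xs ↭ ys → xs ≡ ys
sorted-↭⇒≡ {[]} {[]} _ _ _ = refl
sorted-↭⇒≡ {[]} {y ∷ ys} _ _ p with () ← ↭-length p
sorted-↭⇒≡ {x ∷ xs} {[]} _ _ p with () ← ↭-length p
sorted-↭⇒≡ {x ∷ xs} {y ∷ ys} (x< ∷ sx) (y< ∷ sy) p
  with ∈-resp-↭ p (here refl) | ∈-resp-↭ (↭-sym p) (here refl)
... | here refl | _ = cong (x ∷_) (sorted-↭⇒≡ sx sy (drop-∷ p))
... | there _ | here refl = cong (x ∷_) (sorted-↭⇒≡ sx sy (drop-∷ p))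
... | there x∈ys | there y∈xs = ⊥-elim (ℕ.<-asym (All.lookup y< x∈ys) (All.lookup x< y∈xs))

insert-sorted : ∀ t G → Sorted G → All (λ u → root t ≢ root u) G → ∃ λ G′ → G′ ↭ t ∷ G × Sorted G′
insert-sorted t [] _ _ = t ∷ [] , ↭-refl , [] ∷ []
insert-sorted t (u ∷ G) (u< ∷ sG) (t≢u ∷ t≢G) with ℕ.<-cmp (root t) (root u)
... | tri< t<u _ _ = t ∷ u ∷ G , ↭-refl , (t<u ∷ All.map (ℕ.<-trans t<u) u<) ∷ u< ∷ sG
... | tri≈ _ t≡u _ = ⊥-elim (t≢u t≡u)
... | tri> _ _ u<t with insert-sorted t G sG t≢G
...   | G′ , p , sG′ = u ∷ G′ , ↭-trans (prep u p) (swap u t ↭-refl) , All-resp-↭ (↭-sym p) (u<t ∷ u<) ∷ sG′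

sort-forest : ∀ ts → AllPairs (λ t u → root t ≢ root u) ts → ∃ λ G → G ↭ ts × Sorted G
sort-forest [] _ = [] , ↭-refl , []
sort-forest (t ∷ ts) (t≢ ∷ distinct) with sort-forest ts distinct
... | G , p , sG with insert-sorted t G sG (All-resp-↭ (↭-sym p) t≢)
...   | G′ , p′ , sG′ = G′ , ↭-trans p′ (prep t p) , sG′

roots-distinct : ∀ ts → Unique (labelsF ts) → AllPairs (λ t u → root t ≢ root u) ts
roots-distinct [] _ = []
roots-distinct (node v cs ∷ ts) (v∉ ∷ u) =
  All.tabulate (λ t∈ts v≡ → All.lookup v∉ (∈-++⁺ʳ (labelsF cs) (root∈labelsF t∈ts)) v≡)
  ∷ roots-distinct ts (drop-prefix (labelsF cs) u)
  where
  drop-prefix : ∀ xs {ys} → Unique (xs ++ ys) → Unique ys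
  drop-prefix [] u = u
  drop-prefix (_ ∷ xs) (_ ∷ u) = drop-prefix xs u

removals : List Tree → List (Tree × List Tree)
removals [] = []
removals (t ∷ ts) = (t , ts) ∷ map (λ p → proj₁ p , t ∷ proj₂ p) (removals ts)

removal-↭ : ∀ {G y G′} → (y , G′) ∈ removals G → G ↭ y ∷ G′
removal-↭ {t ∷ ts} (here refl) = ↭-refl
removal-↭ {t ∷ ts} (there m) with ∈-map⁻ _ m
... | (y , ys) , m′ , refl = ↭-trans (prep t (removal-↭ m′)) (swap t y ↭-refl)

removal-sorted : ∀ {G y G′} → (y , G′) ∈ removals G → Sorted G → Sorted G′
removal-sorted {t ∷ ts} (here refl) (_ ∷ s) = s
removal-sorted {t ∷ ts} (there m) (t< ∷ s) with ∈-map⁻ _ m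
... | (y , ys) , m′ , refl =
  All.tabulate (λ u∈ys → All.lookup t< (∈-resp-↭ (↭-sym (removal-↭ m′)) (there u∈ys))) ∷ removal-sorted m′ s

removal-exists : ∀ {G x} → x ∈ G → ∃ λ G′ → (x , G′) ∈ removals G
removal-exists {t ∷ ts} (here refl) = ts , here refl
removal-exists {t ∷ ts} (there x∈ts) with removal-exists x∈ts
... | G′ , m = t ∷ G′ , there (∈-map⁺ _ m)

removals-removed : ∀ G → map proj₁ (removals G) ≡ G
removals-removed [] = refl
removals-removed (t ∷ ts) = cong (t ∷_) (trans (sym (map-∘ (removals ts))) (removals-removed ts))

length-removals : ∀ G → length (removals G) ≡ length G
length-removals G = trans (sym (length-map proj₁ (removals G))) (cong length (removals-removed G))

removed∈ : ∀ {G y G′} → (y , G′) ∈ removals G → y ∈ G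
removed∈ m = ∈-resp-↭ (↭-sym (removal-↭ m)) (here refl)

removed-later : ∀ {t : Tree} {ts ys : List Tree} → All (t ≢_) ts → (t , ys) ∈ map (λ p → proj₁ p , t ∷ proj₂ p) (removals ts) → ⊥
removed-later t∉ts m with ∈-map⁻ _ m
... | _ , m′ , refl = All.lookup t∉ts (removed∈ m′) refl

removal-unique : ∀ {G y G₁ G₂} → Unique G → (y , G₁) ∈ removals G → (y , G₂) ∈ removals G → G₁ ≡ G₂
removal-unique {t ∷ ts} _ (here refl) (here refl) = refl
removal-unique {t ∷ ts} (t∉ts ∷ _) (here refl) (there m) = ⊥-elim (removed-later t∉ts m)
removal-unique {t ∷ ts} (t∉ts ∷ _) (there m) (here refl) = ⊥-elim (removed-later t∉ts m)
removal-unique {t ∷ ts} (_ ∷ u) (there m₁) (there m₂) with ∈-map⁻ _ m₁ | ∈-map⁻ _ m₂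
... | (y , ys₁) , m₁′ , refl | (.y , ys₂) , m₂′ , refl = cong (t ∷_) (removal-unique u m₁′ m₂′)

prepend : Tree → List Tree × List Tree → List Tree × List Tree
prepend t (s , r) = t ∷ s , r

-- selections n G lists every pair (s , r) where s is an ordered list of at
-- most n distinct trees of G and r lists the remaining trees in their order in G.
selections : ℕ → List Tree → List (List Tree × List Tree)
selections zero G = ([] , G) ∷ []
selections (suc n) G = ([] , G) ∷ concatMap (λ p → map (prepend (proj₁ p)) (selections n (proj₂ p))) (removals G)

selection-cases : ∀ n G {s r} → (s , r) ∈ selections (suc n) G →
  (s ≡ [] × r ≡ G) ⊎ ∃ λ y → ∃ λ G′ → ∃ λ s′ → (y , G′) ∈ removals G × (s′ , r) ∈ selections n G′ × s ≡ y ∷ s′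
selection-cases n G (here refl) = inj₁ (refl , refl)
selection-cases n G (there m) with find (∈-concatMap⁻ _ {xs = removals G} m)
... | (y , G′) , rm , m′ with ∈-map⁻ _ m′
...   | (s′ , r′) , sm , refl = inj₂ (y , G′ , s′ , rm , sm , refl)

selection-↭ : ∀ n G {s r} → (s , r) ∈ selections n G → s ++ r ↭ G
selection-↭ zero G (here refl) = ↭-refl
selection-↭ (suc n) G m with selection-cases n G m
... | inj₁ (refl , refl) = ↭-refl
... | inj₂ (y , G′ , s′ , rm , sm , refl) = ↭-trans (prep y (selection-↭ n G′ sm)) (↭-sym (removal-↭ rm))

selection-sorted : ∀ n G {s r} → (s , r) ∈ selections n G → Sorted G → Sorted r
selection-sorted zero G (here refl) sG = sG
selection-sorted (suc n) G m sG with selection-cases n G m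
... | inj₁ (refl , refl) = sG
... | inj₂ (y , G′ , s′ , rm , sm , refl) = selection-sorted n G′ sm (removal-sorted rm sG)

selection-complete : ∀ n G s r → Sorted G → Sorted r → s ++ r ↭ G → length s ≤ n → (s , r) ∈ selections n G
selection-complete zero G [] r sG sr p _ = here (cong ([] ,_) (sorted-↭⇒≡ sr sG p))
selection-complete (suc n) G [] r sG sr p _ = here (cong ([] ,_) (sorted-↭⇒≡ sr sG p))
selection-complete (suc n) G (x ∷ s) r sG sr p (s≤s |s|≤n) with removal-exists (∈-resp-↭ p (here refl))
... | G′ , rm = there (∈-concatMap _ rm (∈-map⁺ (prepend x) rest))
  where
  rest : (s , r) ∈ selections n G′
  rest = selection-complete n G′ s r (removal-sorted rm sG) sr (drop-∷ (↭-trans p (removal-↭ rm))) |s|≤n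

selections-unique : ∀ n G → Sorted G → Unique (selections n G)
selections-unique zero G _ = [] ∷ []
selections-unique (suc n) G sG =
  All.tabulate nonempty ∷ unique-concatMap block (removals G) removals-unique block-unique blocks-apart
  where
  block : Tree × List Tree → List (List Tree × List Tree)
  block (y , G′) = map (prepend y) (selections n G′)
  nonempty : ∀ {z} → z ∈ concatMap block (removals G) → ([] , G) ≢ z
  nonempty m eq with find (∈-concatMap⁻ block {xs = removals G} m)
  ... | _ , _ , m′ with ∈-map⁻ _ m′
  nonempty m () | _ , _ , _ | _ , _ , refl
  removals-unique : Unique (removals G)
  removals-unique = Unique.map⁻ (subst Unique (sym (removals-removed G)) (sorted⇒unique sG))
  block-unique : ∀ {p} → p ∈ removals G → Unique (block p)
  block-unique {y , G′} rm = Unique.map⁺ prepend-injective (selections-unique n G′ (removal-sorted rm sG))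
    where
    prepend-injective : ∀ {a b} → prepend y a ≡ prepend y b → a ≡ b
    prepend-injective {_ , _} {_ , _} refl = refl
  blocks-apart : ∀ {p q z} → p ∈ removals G → q ∈ removals G → z ∈ block p → z ∈ block q → p ≡ q
  blocks-apart {y , G₁} {y′ , G₂} rm₁ rm₂ m₁ m₂ with ∈-map⁻ _ m₁ | ∈-map⁻ _ m₂
  ... | _ , _ , refl | _ , _ , refl = cong (y ,_) (removal-unique (sorted⇒unique sG) rm₁ rm₂)

range : ℕ → ℕ → List ℕ
range a zero = []
range a (suc n) = suc a ∷ range (suc a) n

range-above : ∀ a n {x} → x ∈ range a n → a < x
range-above a (suc n) (here refl) = ℕ.≤-refl
range-above a (suc n) (there m) = ℕ.<-trans (ℕ.n<1+n a) (range-above (suc a) n m)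

range-unique : ∀ a n → Unique (range a n)
range-unique a zero = []
range-unique a (suc n) = All.tabulate (λ m eq → ℕ.<⇒≢ (range-above (suc a) n m) eq) ∷ range-unique (suc a) n

length-range : ∀ a n → length (range a n) ≡ n
length-range a zero = refl
length-range a (suc n) = cong suc (length-range (suc a) n)

applyUpTo≡range : ∀ (f : ℕ → ℕ) a n → (∀ t → f t ≡ suc (a + t)) → applyUpTo f n ≡ range a n
applyUpTo≡range f a zero _ = refl
applyUpTo≡range f a (suc n) f≗ = cong₂ _∷_ (trans (f≗ 0) (cong suc (ℕ.+-identityʳ a)))
  (applyUpTo≡range (f ∘ suc) (suc a) n (λ t → trans (f≗ (suc t)) (cong suc (ℕ.+-suc a t))))

upTo-suc≡range : ∀ n → applyUpTo suc n ≡ range 0 n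
upTo-suc≡range n = applyUpTo≡range suc 0 n (λ _ → refl)

ForestOn : ℕ → ℕ → Forest → Set
ForestOn a n G = Sorted G × All IncreasingTree G × labelsF G ↭ range a n

#trees≤n : ∀ {a n G} → ForestOn a n G → length G ≤ n
#trees≤n {a} {n} {G} (_ , _ , lab) =
  ℕ.≤-trans (length≤#labels G) (ℕ.≤-reflexive (trans (↭-length lab) (length-range a n)))

attach : ℕ → List Tree × List Tree → Forest
attach u (s , r) = node u s ∷ r

attach-injective : ∀ {u a b} → attach u a ≡ attach u b → a ≡ b
attach-injective {u} {_ , _} {_ , _} refl = refl

forestsOn : ℕ → ℕ → List Forest
forestsOn a zero = [] ∷ []
forestsOn a (suc n) = concatMap (λ G → map (attach (suc a)) (selections n G)) (forestsOn (suc a) n)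

attach-forestOn : ∀ {a n G s r} → ForestOn (suc a) n G → s ++ r ↭ G → Sorted r →
  ForestOn a (suc n) (attach (suc a) (s , r))
attach-forestOn {a} {n} {G} {s} {r} (_ , iG , lG) p sr =
  (All.tabulate (above ∘ ∈-++⁺ʳ s) ∷ sr)
  , increasing-node⁺ {suc a} {s} (All.tabulate (increasing ∘ ∈-++⁺ˡ)) (All.tabulate (above ∘ ∈-++⁺ˡ))
    ∷ All.tabulate (increasing ∘ ∈-++⁺ʳ s)
  , prep (suc a) (↭-trans (↭-reflexive (sym (labelsF-++ s r))) (↭-trans (labelsF-↭ p) lG))
  where
  above : ∀ {t} → t ∈ s ++ r → suc a < root t
  above t∈ = range-above (suc a) n (∈-resp-↭ lG (root∈labelsF (∈-resp-↭ p t∈)))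
  increasing : ∀ {t} → t ∈ s ++ r → IncreasingTree t
  increasing t∈ = All.lookup iG (∈-resp-↭ p t∈)

detach-forestOn : ∀ {a n u s r} → ForestOn a (suc n) (node u s ∷ r) →
  u ≡ suc a × ∃ λ G → G ↭ s ++ r × ForestOn (suc a) n G
detach-forestOn {a} {n} {u} {s} {r} (r-above ∷ _ , iu ∷ ir , p) with increasing-node⁻ iu
... | its , _ = u≡ , detached
  where
  u-minimal : All (u ≤_) (labelsF (node u s ∷ r))
  u-minimal = All.++⁺ (root-minimal (node u s) iu) (All.map ℕ.<⇒≤ (above-parent u r r-above ir))
  u≡ : u ≡ suc a
  u≡ = ℕ.≤-antisym (All.lookup u-minimal (∈-resp-↭ (↭-sym p) (here refl))) (range-above a (suc n) (∈-resp-↭ p (here refl)))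
  rest↭ : labelsF (s ++ r) ↭ range (suc a) n
  rest↭ = ↭-trans (↭-reflexive (labelsF-++ s r)) (drop-∷ (subst (λ w → w ∷ _ ↭ _) u≡ p))
  distinct-roots : AllPairs (λ t t′ → root t ≢ root t′) (s ++ r)
  distinct-roots = roots-distinct (s ++ r) (unique-resp-↭ (↭-sym rest↭) (range-unique (suc a) n))
  detached : ∃ λ G → G ↭ s ++ r × ForestOn (suc a) n G
  detached with sort-forest (s ++ r) distinct-roots
  ... | G , G↭ , sG = G , G↭ , sG , All-resp-↭ (↭-sym G↭) (All.++⁺ its ir) , ↭-trans (labelsF-↭ G↭) rest↭

forestsOn-sound : ∀ a n {F} → F ∈ forestsOn a n → ForestOn a n F
forestsOn-sound a zero (here refl) = [] , [] , ↭-refl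
forestsOn-sound a (suc n) m with find (∈-concatMap⁻ _ {xs = forestsOn (suc a) n} m)
... | G , G∈ , m′ with ∈-map⁻ _ m′
...   | (s , r) , sel , refl = attach-forestOn G-on (selection-↭ n G sel) (selection-sorted n G sel (proj₁ G-on))
  where
  G-on : ForestOn (suc a) n G
  G-on = forestsOn-sound (suc a) n G∈

forestsOn-complete : ∀ a n F → ForestOn a n F → F ∈ forestsOn a n
forestsOn-complete a zero [] _ = here refl
forestsOn-complete a zero (node _ _ ∷ _) (_ , _ , p) with () ← ↭-length p
forestsOn-complete a (suc n) [] (_ , _ , p) with () ← ↭-length p
forestsOn-complete a (suc n) (node u s ∷ r) F-on@(_ ∷ sr , _) with detach-forestOn F-on
... | refl , G , G↭ , G-on =
  ∈-concatMap _ (forestsOn-complete (suc a) n G G-on) (∈-map⁺ (attach (suc a)) sel)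
  where
  |s|≤n : length s ≤ n
  |s|≤n = ℕ.≤-trans (length-++-≤ˡ s) (ℕ.≤-trans (ℕ.≤-reflexive (↭-length (↭-sym G↭))) (#trees≤n G-on))
  sel : (s , r) ∈ selections n G
  sel = selection-complete n G s r (proj₁ G-on) sr (↭-sym G↭) |s|≤n

forestsOn-unique : ∀ a n → Unique (forestsOn a n)
forestsOn-unique a zero = [] ∷ []
forestsOn-unique a (suc n) = unique-concatMap block (forestsOn (suc a) n) (forestsOn-unique (suc a) n) block-unique blocks-apart
  where
  block : Forest → List Forest
  block G = map (attach (suc a)) (selections n G)
  block-unique : ∀ {G} → G ∈ forestsOn (suc a) n → Unique (block G)
  block-unique {G} G∈ = Unique.map⁺ attach-injective (selections-unique n G (proj₁ (forestsOn-sound (suc a) n G∈)))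
  blocks-apart : ∀ {G₁ G₂ F} → G₁ ∈ forestsOn (suc a) n → G₂ ∈ forestsOn (suc a) n → F ∈ block G₁ → F ∈ block G₂ → G₁ ≡ G₂
  blocks-apart {G₁} {G₂} G₁∈ G₂∈ m₁ m₂ with ∈-map⁻ _ m₁ | ∈-map⁻ _ m₂
  ... | (s , r) , sel₁ , refl | sr₂ , sel₂ , eq with attach-injective {suc a} {s , r} {sr₂} eq
  ...   | refl = sorted-↭⇒≡ (proj₁ (forestsOn-sound (suc a) n G₁∈)) (proj₁ (forestsOn-sound (suc a) n G₂∈))
                   (↭-trans (↭-sym (selection-↭ n G₁ sel₁)) (selection-↭ n G₂ sel₂))

count : {A : Set} → (A → Bool) → List A → ℕ
count p xs = length (filterᵇ p xs)

module _ {A : Set} (p : A → Bool) where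

  count-∷ : ∀ x xs → count p (x ∷ xs) ≡ (if p x then suc (count p xs) else count p xs)
  count-∷ x xs with p x
  ... | true = refl
  ... | false = refl

  count-++ : ∀ xs ys → count p (xs ++ ys) ≡ count p xs + count p ys
  count-++ xs ys = trans (cong length (filter-++ (T? ∘ p) xs ys)) (length-++ (filterᵇ p xs))

  count-↭ : ∀ {xs ys} → xs ↭ ys → count p xs ≡ count p ys
  count-↭ xs↭ys = ↭-length (filter-↭ (T? ∘ p) xs↭ys)

  count≤length : ∀ xs → count p xs ≤ length xs
  count≤length = length-filter (T? ∘ p)

  count-none : ∀ xs → All (λ x → p x ≡ false) xs → count p xs ≡ 0
  count-none [] _ = refl
  count-none (x ∷ xs) (px ∷ pxs) =
    trans (count-∷ x xs) (trans (cong (λ b → if b then suc (count p xs) else count p xs) px) (count-none xs pxs))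

  count+count-not : ∀ xs → count p xs + count (not ∘ p) xs ≡ length xs
  count+count-not [] = refl
  count+count-not (x ∷ xs) with p x
  ... | true = cong suc (count+count-not xs)
  ... | false = trans (ℕ.+-suc (count p xs) _) (cong suc (count+count-not xs))

count-cong : ∀ {A : Set} (p q : A → Bool) xs → (∀ {x} → x ∈ xs → p x ≡ q x) → count p xs ≡ count q xs
count-cong p q [] _ = refl
count-cong p q (x ∷ xs) p≗q =
  trans (count-∷ p x xs) (trans (cong₂ (λ b n → if b then suc n else n) (p≗q (here refl)) (count-cong p q xs (p≗q ∘ there)))
    (sym (count-∷ q x xs)))

count-map : ∀ {A B : Set} (p : B → Bool) (f : A → B) xs → count p (map f xs) ≡ count (p ∘ f) xs
count-map p f [] = refl
count-map p f (x ∷ xs) with p (f x)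
... | true = cong suc (count-map p f xs)
... | false = count-map p f xs

crosses : ℕ → ℕ × ℕ → Bool
crosses v e = (proj₁ e <ᵇ v) ∧ (v <ᵇ proj₂ e)

reaches : ℕ → Tree → Bool
reaches v t = any (_≤ᵇ v) (labels t)

level-↭ : ∀ {F F′} v → F ↭ F′ → level F v ≡ level F′ v
level-↭ v F↭F′ =
  cong₂ _+_ (count-↭ (crosses v) (edgesF-↭ F↭F′)) (cong₂ _∸_ (cong suc (↭-length F↭F′)) (count-↭ (reaches v) F↭F′))

<ᵇ≡not-≤ᵇ : ∀ x v → (v <ᵇ x) ≡ not (x ≤ᵇ v)
<ᵇ≡not-≤ᵇ x v with x ≤ᵇ v in x≤ᵇv
... | true = reflects-false (ℕ.<ᵇ-reflects-< v x) (ℕ.≤⇒≯ (reflected (ℕ.≤ᵇ-reflects-≤ x v) x≤ᵇv))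
... | false = reflects-true (ℕ.<ᵇ-reflects-< v x) (ℕ.≰⇒> (not-reflected (ℕ.≤ᵇ-reflects-≤ x v) x≤ᵇv))

-- Arithmetic of the term (k + 1 − r_v): moving c trees that reach v and
-- A trees that do not into the forest.
deficit-shift : ∀ A c k R → R ≤ k → A + (suc k ∸ R) ≡ suc ((A + c) + k) ∸ (c + R)
deficit-shift A c k R R≤k = begin
  A + (suc k ∸ R)                ≡⟨ ℕ.+-∸-assoc A (ℕ.m≤n⇒m≤1+n R≤k) ⟨
  (A + suc k) ∸ R                ≡⟨ ℕ.[m+n]∸[m+o]≡n∸o c (A + suc k) R ⟨
  (c + (A + suc k)) ∸ (c + R)    ≡⟨ cong (_∸ (c + R)) (solve 3 (λ A c k → c :+ (A :+ (con 1 :+ k)) := con 1 :+ ((A :+ c) :+ k)) refl A c k) ⟩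
  suc ((A + c) + k) ∸ (c + R)    ∎
  where
  open ≡-Reasoning
  open +-*-Solver

level-below : ∀ u s r v → All IncreasingTree s → u < v → level (node u s ∷ r) v ≡ level (s ++ r) v
level-below u s r v s-inc u<v = begin
  level (node u s ∷ r) v                                    ≡⟨ cong₂ _+_ crosses-F (cong (suc (suc (length r)) ∸_) reaches-F) ⟩
  ((A + Es) + Er) + (suc (length r) ∸ Rr)                   ≡⟨ solve 4 (λ A Es Er D → ((A :+ Es) :+ Er) :+ D := (Es :+ Er) :+ (A :+ D)) refl A Es Er (suc (length r) ∸ Rr) ⟩
  (Es + Er) + (A + (suc (length r) ∸ Rr))                   ≡⟨ cong ((Es + Er) +_) (deficit-shift A Rs (length r) Rr (count≤length (reaches v) r)) ⟩
  (Es + Er) + (suc ((A + Rs) + length r) ∸ (Rs + Rr))       ≡⟨ cong₂ _+_ crosses-G (cong₂ _∸_ (cong suc length-G) reaches-G) ⟨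
  level (s ++ r) v                                          ∎
  where
  open ≡-Reasoning
  open +-*-Solver
  A Es Er Rs Rr : ℕ
  A = count (λ t → v <ᵇ root t) s
  Es = count (crosses v) (edgesF s)
  Er = count (crosses v) (edgesF r)
  Rs = count (λ t → root t ≤ᵇ v) s
  Rr = count (reaches v) r
  -- the edges from u that cross v are those to children above v
  crosses-F : count (crosses v) (edgesF (node u s ∷ r)) ≡ (A + Es) + Er
  crosses-F = begin
    count (crosses v) ((map (λ t → u , root t) s ++ edgesF s) ++ edgesF r)
      ≡⟨ count-++ (crosses v) (map (λ t → u , root t) s ++ edgesF s) (edgesF r) ⟩
    count (crosses v) (map (λ t → u , root t) s ++ edgesF s) + Er
      ≡⟨ cong (_+ Er) (count-++ (crosses v) (map (λ t → u , root t) s) (edgesF s)) ⟩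
    (count (crosses v) (map (λ t → u , root t) s) + Es) + Er
      ≡⟨ cong (λ n → (n + Es) + Er) (count-map (crosses v) (λ t → u , root t) s) ⟩
    (count (λ t → (u <ᵇ v) ∧ (v <ᵇ root t)) s + Es) + Er
      ≡⟨ cong (λ b → (count (λ t → b ∧ (v <ᵇ root t)) s + Es) + Er) (reflects-true (ℕ.<ᵇ-reflects-< u v) u<v) ⟩
    (A + Es) + Er ∎
  -- the tree rooted at u reaches v
  reaches-F : count (reaches v) (node u s ∷ r) ≡ suc Rr
  reaches-F = trans (count-∷ (reaches v) (node u s) r)
    (cong (λ b → if b ∨ any (_≤ᵇ v) (labelsF s) then suc Rr else Rr) (reflects-true (ℕ.≤ᵇ-reflects-≤ u v) (ℕ.<⇒≤ u<v)))
  -- an increasing child subtree reaches v iff its root is ≤ v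
  reaches-s : count (reaches v) s ≡ Rs
  reaches-s = count-cong (reaches v) (λ t → root t ≤ᵇ v) s (λ {t} t∈s → any≤-increasing t v (All.lookup s-inc t∈s))
  length-s : A + Rs ≡ length s
  length-s = trans (cong (_+ Rs) (count-cong _ (not ∘ (λ t → root t ≤ᵇ v)) s (λ {t} _ → <ᵇ≡not-≤ᵇ (root t) v)))
                   (trans (ℕ.+-comm _ Rs) (count+count-not (λ t → root t ≤ᵇ v) s))
  crosses-G : count (crosses v) (edgesF (s ++ r)) ≡ Es + Er
  crosses-G = trans (cong (count (crosses v)) (edgesF-++ s r)) (count-++ (crosses v) (edgesF s) (edgesF r))
  length-G : length (s ++ r) ≡ (A + Rs) + length r
  length-G = trans (length-++ s) (cong (_+ length r) (sym length-s))
  reaches-G : count (reaches v) (s ++ r) ≡ Rs + Rr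
  reaches-G = trans (count-++ (reaches v) s r) (cong (_+ Rr) reaches-s)

level-minimum : ∀ u s r → All (u <_) (labelsF s) → All (u <_) (labelsF r) → level (node u s ∷ r) u ≡ suc (length r)
level-minimum u s r s-above r-above = cong₂ _+_ no-crossing (cong (suc (suc (length r)) ∸_) reaches-F)
  where
  F : Forest
  F = node u s ∷ r
  u-minimal : All (u ≤_) (labelsF F)
  u-minimal = ℕ.≤-refl ∷ All.++⁺ (All.map ℕ.<⇒≤ s-above) (All.map ℕ.<⇒≤ r-above)
  no-crossing : count (crosses u) (edgesF F) ≡ 0
  no-crossing = count-none (crosses u) (edgesF F)
    (All.map (λ {e} u≤p → cong (_∧ (u <ᵇ proj₂ e)) (reflects-false (ℕ.<ᵇ-reflects-< (proj₁ e) u) (ℕ.≤⇒≯ u≤p)))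
             (edgesF-parents F u-minimal))
  reaches-F : count (reaches u) F ≡ 1
  reaches-F = trans (count-∷ (reaches u) (node u s) r)
    (trans (cong (λ b → if b ∨ any (_≤ᵇ u) (labelsF s) then suc (count (reaches u) r) else count (reaches u) r)
                 (reflects-true (ℕ.≤ᵇ-reflects-≤ u u) ℕ.≤-refl))
           (cong suc (count-none (reaches u) r (All.tabulate (λ t∈r → none≤ (labels _)
              (All.tabulate (λ x∈t → All.lookup r-above (label∈labelsF t∈r x∈t))))))))

module RingSums {c ℓ : Level} (R : CommutativeRing c ℓ) where
  open CommutativeRing R renaming (_+_ to _⊕_; _*_ to _⊗_; refl to ≈-refl; sym to ≈-sym; trans to ≈-trans)
  open import Relation.Binary.Reasoning.Setoid setoid

  sum-↭ : ∀ {xs ys} → xs ↭ ys → sumR R xs ≈ sumR R ys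
  sum-↭ p = PermSetoid.foldr-commMonoid setoid +-isCommutativeMonoid (↭⇒↭ₛ′ isEquivalence p)

  prod-↭ : ∀ {xs ys} → xs ↭ ys → prodR R xs ≈ prodR R ys
  prod-↭ p = PermSetoid.foldr-commMonoid setoid *-isCommutativeMonoid (↭⇒↭ₛ′ isEquivalence p)

  ≡⇒≈ : ∀ {x y} → x ≡ y → x ≈ y
  ≡⇒≈ ≡.refl = ≈-refl

  Σ : {A : Set} → (A → Carrier) → List A → Carrier
  Σ f xs = sumR R (map f xs)

  Σ< : ℕ → (ℕ → Carrier) → Carrier
  Σ< N f = sumR R (applyUpTo f N)

  +-interchange : ∀ a b x y → (a ⊕ b) ⊕ (x ⊕ y) ≈ (a ⊕ x) ⊕ (b ⊕ y)
  +-interchange a b x y = begin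
    (a ⊕ b) ⊕ (x ⊕ y) ≈⟨ +-assoc a b (x ⊕ y) ⟩
    a ⊕ (b ⊕ (x ⊕ y)) ≈⟨ +-congˡ (+-assoc b x y) ⟨
    a ⊕ ((b ⊕ x) ⊕ y) ≈⟨ +-congˡ (+-congʳ (+-comm b x)) ⟩
    a ⊕ ((x ⊕ b) ⊕ y) ≈⟨ +-congˡ (+-assoc x b y) ⟩
    a ⊕ (x ⊕ (b ⊕ y)) ≈⟨ +-assoc a x (b ⊕ y) ⟨
    (a ⊕ x) ⊕ (b ⊕ y) ∎

  sum-++ : ∀ xs ys → sumR R (xs ++ ys) ≈ sumR R xs ⊕ sumR R ys
  sum-++ [] ys = ≈-sym (+-identityˡ _)
  sum-++ (x ∷ xs) ys = ≈-trans (+-congˡ (sum-++ xs ys)) (≈-sym (+-assoc _ _ _))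

  prod-++ : ∀ xs ys → prodR R (xs ++ ys) ≈ prodR R xs ⊗ prodR R ys
  prod-++ [] ys = ≈-sym (*-identityˡ _)
  prod-++ (x ∷ xs) ys = ≈-trans (*-congˡ (prod-++ xs ys)) (≈-sym (*-assoc _ _ _))

  Σ-cong : ∀ {A : Set} {f g : A → Carrier} xs → (∀ {x} → x ∈ xs → f x ≈ g x) → Σ f xs ≈ Σ g xs
  Σ-cong [] _ = ≈-refl
  Σ-cong (x ∷ xs) f≈g = +-cong (f≈g (here ≡.refl)) (Σ-cong xs (f≈g ∘ there))

  Σ-+ : ∀ {A : Set} (f g : A → Carrier) xs → Σ (λ x → f x ⊕ g x) xs ≈ Σ f xs ⊕ Σ g xs
  Σ-+ f g [] = ≈-sym (+-identityˡ 0#)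
  Σ-+ f g (x ∷ xs) = ≈-trans (+-congˡ (Σ-+ f g xs)) (+-interchange _ _ _ _)

  Σ-*ʳ : ∀ {A : Set} (f : A → Carrier) xs c → Σ f xs ⊗ c ≈ Σ (λ x → f x ⊗ c) xs
  Σ-*ʳ f [] c = zeroˡ c
  Σ-*ʳ f (x ∷ xs) c = ≈-trans (distribʳ c (f x) _) (+-congˡ (Σ-*ʳ f xs c))

  Σ-map : ∀ {A B : Set} (h : B → Carrier) (g : A → B) xs → Σ h (map g xs) ≈ Σ (h ∘ g) xs
  Σ-map h g xs = ≡⇒≈ (≡.cong (sumR R) (≡.sym (map-∘ xs)))

  Σ-concatMap : ∀ {A B : Set} (h : B → Carrier) (g : A → List B) xs →
    Σ h (concatMap g xs) ≈ Σ (λ x → Σ h (g x)) xs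
  Σ-concatMap h g [] = ≈-refl
  Σ-concatMap h g (x ∷ xs) = begin
    sumR R (map h (g x ++ concatMap g xs))         ≡⟨ ≡.cong (sumR R) (map-++ h (g x) _) ⟩
    sumR R (map h (g x) ++ map h (concatMap g xs)) ≈⟨ sum-++ (map h (g x)) _ ⟩
    Σ h (g x) ⊕ Σ h (concatMap g xs)               ≈⟨ +-congˡ (Σ-concatMap h g xs) ⟩
    Σ h (g x) ⊕ Σ (λ x → Σ h (g x)) xs             ∎

  Σ-const : ∀ {A : Set} (f : A → Carrier) xs c → (∀ {x} → x ∈ xs → f x ≈ c) → Σ f xs ≈ fromℕ R (length xs) ⊗ c
  Σ-const f [] c _ = ≈-sym (zeroˡ c)
  Σ-const f (x ∷ xs) c f≈c = begin
    f x ⊕ Σ f xs                              ≈⟨ +-cong (f≈c (here ≡.refl)) (Σ-const f xs c (f≈c ∘ there)) ⟩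
    c ⊕ fromℕ R (length xs) ⊗ c               ≈⟨ +-congʳ (*-identityˡ c) ⟨
    1# ⊗ c ⊕ fromℕ R (length xs) ⊗ c          ≈⟨ distribʳ c 1# _ ⟨
    (1# ⊕ fromℕ R (length xs)) ⊗ c            ∎

  Σ-filter : ∀ {A : Set} (f : A → Carrier) (p : A → Bool) xs →
    Σ f (filterᵇ p xs) ≈ Σ (λ x → if p x then f x else 0#) xs
  Σ-filter f p [] = ≈-refl
  Σ-filter f p (x ∷ xs) with p x
  ... | true = +-congˡ (Σ-filter f p xs)
  ... | false = ≈-trans (Σ-filter f p xs) (≈-sym (+-identityˡ _))

  Σ<-cong : ∀ N {f g} → (∀ j → j < N → f j ≈ g j) → Σ< N f ≈ Σ< N g
  Σ<-cong zero _ = ≈-refl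
  Σ<-cong (suc N) f≈g = +-cong (f≈g 0 (s≤s z≤n)) (Σ<-cong N (λ j j<N → f≈g (suc j) (s≤s j<N)))

  Σ<-zero : ∀ N f → (∀ j → j < N → f j ≈ 0#) → Σ< N f ≈ 0#
  Σ<-zero zero f _ = ≈-refl
  Σ<-zero (suc N) f f≈0 =
    ≈-trans (+-cong (f≈0 0 (s≤s z≤n)) (Σ<-zero N (f ∘ suc) (λ j j<N → f≈0 (suc j) (s≤s j<N)))) (+-identityˡ 0#)

  Σ<-*ˡ : ∀ N c f → c ⊗ Σ< N f ≈ Σ< N (λ j → c ⊗ f j)
  Σ<-*ˡ zero c f = zeroʳ c
  Σ<-*ˡ (suc N) c f = ≈-trans (distribˡ c _ _) (+-congˡ (Σ<-*ˡ N c (f ∘ suc)))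

  Σ<-*ʳ : ∀ N c f → Σ< N f ⊗ c ≈ Σ< N (λ j → f j ⊗ c)
  Σ<-*ʳ zero c f = zeroˡ c
  Σ<-*ʳ (suc N) c f = ≈-trans (distribʳ c _ _) (+-congˡ (Σ<-*ʳ N c (f ∘ suc)))

  Σ<-Σ : ∀ {A : Set} N (f : ℕ → A → Carrier) xs → Σ< N (λ j → Σ (f j) xs) ≈ Σ (λ x → Σ< N (λ j → f j x)) xs
  Σ<-Σ zero f xs = ≈-sym (Σ-zero xs)
    where
    Σ-zero : ∀ xs → Σ (λ _ → 0#) xs ≈ 0#
    Σ-zero [] = ≈-refl
    Σ-zero (_ ∷ xs) = ≈-trans (+-identityˡ _) (Σ-zero xs)
  Σ<-Σ (suc N) f xs = ≈-trans (+-congˡ (Σ<-Σ N (f ∘ suc) xs)) (≈-sym (Σ-+ (f 0) _ xs))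

  Σ<-Σ< : ∀ N L (f : ℕ → ℕ → Carrier) → Σ< N (λ j → Σ< L (f j)) ≈ Σ< L (λ l → Σ< N (λ j → f j l))
  Σ<-Σ< zero L f = ≈-sym (Σ<-zero L _ (λ _ _ → ≈-refl))
  Σ<-Σ< (suc N) L f = ≈-trans (+-congˡ (Σ<-Σ< N L (f ∘ suc))) (≈-sym (Σ<-+ L))
    where
    Σ<-+ : ∀ L {g h : ℕ → Carrier} → Σ< L (λ l → g l ⊕ h l) ≈ Σ< L g ⊕ Σ< L h
    Σ<-+ zero = ≈-sym (+-identityˡ 0#)
    Σ<-+ (suc L) = ≈-trans (+-congˡ (Σ<-+ L)) (+-interchange _ _ _ _)

  Σ<-extend : ∀ N N′ f → N ≤ N′ → (∀ l → N ≤ l → l < N′ → f l ≈ 0#) → Σ< N f ≈ Σ< N′ f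
  Σ<-extend zero N′ f _ f≈0 = ≈-sym (Σ<-zero N′ f (λ l → f≈0 l z≤n))
  Σ<-extend (suc N) (suc N′) f (s≤s N≤N′) f≈0 =
    +-congˡ (Σ<-extend N N′ (f ∘ suc) N≤N′ (λ l N≤l l<N′ → f≈0 (suc l) (s≤s N≤l) (s≤s l<N′)))

  Σ<-select : ∀ N m (g : ℕ → Carrier) → m < N → Σ< N (λ j → if m ≡ᵇ j then g j else 0#) ≈ g m
  Σ<-select (suc N) zero g _ = ≈-trans (+-congˡ (Σ<-zero N _ (λ _ _ → ≈-refl))) (+-identityʳ (g 0))
  Σ<-select (suc N) (suc m) g (s≤s m<N) = ≈-trans (+-identityˡ _) (Σ<-select N m (g ∘ suc) m<N)

  fromℕ-+ : ∀ a b → fromℕ R (a ℕ.+ b) ≈ fromℕ R a ⊕ fromℕ R b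
  fromℕ-+ zero b = ≈-sym (+-identityˡ _)
  fromℕ-+ (suc a) b = ≈-trans (+-congˡ (fromℕ-+ a b)) (≈-sym (+-assoc _ _ _))

  fromℕ-* : ∀ a b → fromℕ R (a ℕ.* b) ≈ fromℕ R a ⊗ fromℕ R b
  fromℕ-* zero b = ≈-sym (zeroˡ _)
  fromℕ-* (suc a) b = begin
    fromℕ R (b ℕ.+ a ℕ.* b)                  ≈⟨ fromℕ-+ b (a ℕ.* b) ⟩
    fromℕ R b ⊕ fromℕ R (a ℕ.* b)            ≈⟨ +-cong (≈-sym (*-identityˡ _)) (fromℕ-* a b) ⟩
    1# ⊗ fromℕ R b ⊕ fromℕ R a ⊗ fromℕ R b   ≈⟨ distribʳ _ _ _ ⟨
    (1# ⊕ fromℕ R a) ⊗ fromℕ R b             ∎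

  fromℕ-1 : fromℕ R 1 ≈ 1#
  fromℕ-1 = +-identityʳ 1#

  Σ<-assoc : ∀ N L (a : ℕ → Carrier) (b : ℕ → ℕ → Carrier) (d : ℕ → Carrier) →
    Σ< N (λ j → a j ⊗ Σ< L (λ l → b j l ⊗ d l)) ≈ Σ< L (λ l → Σ< N (λ j → a j ⊗ b j l) ⊗ d l)
  Σ<-assoc N L a b d = begin
    Σ< N (λ j → a j ⊗ Σ< L (λ l → b j l ⊗ d l))    ≈⟨ Σ<-cong N (λ j _ → Σ<-*ˡ L (a j) _) ⟩
    Σ< N (λ j → Σ< L (λ l → a j ⊗ (b j l ⊗ d l)))  ≈⟨ Σ<-Σ< N L _ ⟩
    Σ< L (λ l → Σ< N (λ j → a j ⊗ (b j l ⊗ d l)))  ≈⟨ Σ<-cong L (λ l _ → Σ<-cong N (λ j _ → ≈-sym (*-assoc _ _ _))) ⟩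
    Σ< L (λ l → Σ< N (λ j → (a j ⊗ b j l) ⊗ d l))  ≈⟨ Σ<-cong L (λ l _ → Σ<-*ʳ N (d l) _) ⟨
    Σ< L (λ l → Σ< N (λ j → a j ⊗ b j l) ⊗ d l)    ∎

≡ᵇ-sym : ∀ i j → (i ≡ᵇ j) ≡ (j ≡ᵇ i)
≡ᵇ-sym zero zero = ≡.refl
≡ᵇ-sym zero (suc j) = ≡.refl
≡ᵇ-sym (suc i) zero = ≡.refl
≡ᵇ-sym (suc i) (suc j) = ≡ᵇ-sym i j

module Powers {c ℓ : Level} (R : CommutativeRing c ℓ) where
  open CommutativeRing R renaming (_+_ to _⊕_; _*_ to _⊗_; refl to ≈-refl; sym to ≈-sym; trans to ≈-trans)
  open RingSums R
  open import Relation.Binary.Reasoning.Setoid setoid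

  pow : (ℕ → ℕ → Carrier) → ℕ → ℕ → ℕ → Carrier
  pow M = matPow R M (hessBound R)

  select-left : ∀ b x → (if b then 1# else 0#) ⊗ x ≈ (if b then x else 0#)
  select-left true x = *-identityˡ x
  select-left false x = zeroˡ x

  select-right : ∀ b x → x ⊗ (if b then 1# else 0#) ≈ (if b then x else 0#)
  select-right true x = *-identityʳ x
  select-right false x = zeroʳ x

  power-similar : (A B : ℕ → ℕ → Carrier) (d : ℕ → Carrier) → (∀ i j → A i j ⊗ d j ≈ d i ⊗ B i j) →
    ∀ m i k → pow A m i k ⊗ d k ≈ d i ⊗ pow B m i k
  power-similar A B d AD≈DB zero i k with i ≡ᵇ k in i≡ᵇk
  ... | true rewrite reflected (≡ᵇ-reflects-≡ i k) i≡ᵇk = ≈-trans (*-identityˡ _) (≈-sym (*-identityʳ _))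
  ... | false = ≈-trans (zeroˡ _) (≈-sym (zeroʳ _))
  power-similar A B d AD≈DB (suc m) i k = begin
    Σ< (suc (suc i)) (λ j → A i j ⊗ pow A m j k) ⊗ d k   ≈⟨ Σ<-*ʳ (suc (suc i)) (d k) (λ j → A i j ⊗ pow A m j k) ⟩
    Σ< (suc (suc i)) (λ j → (A i j ⊗ pow A m j k) ⊗ d k) ≈⟨ Σ<-cong (suc (suc i)) (λ j _ → step j) ⟩
    Σ< (suc (suc i)) (λ j → d i ⊗ (B i j ⊗ pow B m j k)) ≈⟨ Σ<-*ˡ (suc (suc i)) (d i) (λ j → B i j ⊗ pow B m j k) ⟨
    d i ⊗ Σ< (suc (suc i)) (λ j → B i j ⊗ pow B m j k)   ∎
    where
    step : ∀ j → (A i j ⊗ pow A m j k) ⊗ d k ≈ d i ⊗ (B i j ⊗ pow B m j k)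
    step j = begin
      (A i j ⊗ pow A m j k) ⊗ d k ≈⟨ *-assoc _ _ _ ⟩
      A i j ⊗ (pow A m j k ⊗ d k) ≈⟨ *-congˡ (power-similar A B d AD≈DB m j k) ⟩
      A i j ⊗ (d j ⊗ pow B m j k) ≈⟨ *-assoc _ _ _ ⟨
      (A i j ⊗ d j) ⊗ pow B m j k ≈⟨ *-congʳ (AD≈DB i j) ⟩
      (d i ⊗ B i j) ⊗ pow B m j k ≈⟨ *-assoc _ _ _ ⟩
      d i ⊗ (B i j ⊗ pow B m j k) ∎

  module Hessenberg (M : ℕ → ℕ → Carrier) (hessenberg : ∀ i j → suc (suc i) ≤ j → M i j ≈ 0#) where

    power-support : ∀ m i j → i + m < j → pow M m i j ≈ 0#
    power-support zero i j i<j
      rewrite reflects-false (≡ᵇ-reflects-≡ i j) (λ i≡j → ℕ.<-irrefl i≡j (ℕ.≤-trans (ℕ.≤-reflexive (≡.cong suc (≡.sym (ℕ.+-identityʳ i)))) i<j)) = ≈-refl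
    power-support (suc m) i j i+m<j = Σ<-zero (suc (suc i)) (λ l → M i l ⊗ pow M m l j) (λ l l<i+2 → ≈-trans (*-congˡ (power-support m l j (bound l l<i+2))) (zeroʳ _))
      where
      bound : ∀ l → l < suc (suc i) → l + m < j
      bound l l<i+2 = ℕ.≤-<-trans (ℕ.≤-trans (ℕ.+-monoˡ-≤ m (ℕ.≤-pred l<i+2)) (ℕ.≤-reflexive (≡.sym (ℕ.+-suc i m)))) i+m<j

    power-right : ∀ m i k → pow M (suc m) i k ≈ Σ< (suc (i + m)) (λ j → pow M m i j ⊗ M j k)
    power-right zero i k = ≈-trans row-times-unit (≈-sym unit-times-column)
      where
      row-times-unit : Σ< (suc (suc i)) (λ j → M i j ⊗ pow M 0 j k) ≈ M i k
      row-times-unit with k ℕ.<? suc (suc i)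
      ... | yes k<i+2 = ≈-trans (Σ<-cong (suc (suc i)) (λ j _ → ≈-trans (select-right (j ≡ᵇ k) (M i j))
                                (≡⇒≈ (≡.cong (λ b → if b then M i j else 0#) (≡ᵇ-sym j k)))))
                              (Σ<-select (suc (suc i)) k (M i) k<i+2)
      ... | no k≮i+2 = ≈-trans (Σ<-zero (suc (suc i)) (λ j → M i j ⊗ pow M 0 j k) (λ j j<i+2 → ≈-trans (select-right (j ≡ᵇ k) (M i j))
                               (≡⇒≈ (≡.cong (λ b → if b then M i j else 0#)
                                 (reflects-false (≡ᵇ-reflects-≡ j k) (λ { ≡.refl → k≮i+2 j<i+2 }))))))
                             (≈-sym (hessenberg i k (ℕ.≮⇒≥ k≮i+2)))
      unit-times-column : Σ< (suc (i + 0)) (λ j → pow M 0 i j ⊗ M j k) ≈ M i k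
      unit-times-column = ≈-trans (Σ<-cong (suc (i + 0)) (λ j _ → select-left (i ≡ᵇ j) (M j k)))
                                (Σ<-select (suc (i + 0)) i (λ j → M j k) (s≤s (ℕ.≤-reflexive (≡.sym (ℕ.+-identityʳ i)))))
    power-right (suc m) i k = begin
      Σ< (suc (suc i)) (λ j → M i j ⊗ pow M (suc m) j k)
        ≈⟨ Σ<-cong (suc (suc i)) {λ j → M i j ⊗ pow M (suc m) j k} (λ j j<i+2 → *-cong ≈-refl (expand j j<i+2)) ⟩
      Σ< (suc (suc i)) (λ j → M i j ⊗ Σ< L (λ l → pow M m j l ⊗ M l k))
        ≈⟨ Σ<-assoc (suc (suc i)) L (M i) (pow M m) (λ l → M l k) ⟩
      Σ< L (λ l → pow M (suc m) i l ⊗ M l k) ∎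
      where
      L : ℕ
      L = suc (i + suc m)
      -- by induction, with the range of summation extended to the common bound L
      expand : ∀ j → j < suc (suc i) → pow M (suc m) j k ≈ Σ< L (λ l → pow M m j l ⊗ M l k)
      expand j j<i+2 = ≈-trans (power-right m j k)
        (Σ<-extend (suc (j + m)) L (λ l → pow M m j l ⊗ M l k) (s≤s (ℕ.≤-trans (ℕ.+-monoˡ-≤ m (ℕ.≤-pred j<i+2)) (ℕ.≤-reflexive (≡.sym (ℕ.+-suc i m)))))
          (λ l j+m<l _ → ≈-trans (*-congʳ (power-support m j l j+m<l)) (zeroˡ _)))

P≡P′ : ∀ {n k} → k ≤ n → n P k ≡ n P′ k
P≡P′ {n} {k} k≤n rewrite reflects-true (ℕ.≤ᵇ-reflects-≤ k n) k≤n = ≡.refl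

module Weights {c ℓ : Level} (R : CommutativeRing c ℓ) (φ : ℕ → ℕ → CommutativeRing.Carrier R) where
  open CommutativeRing R renaming (_+_ to _⊕_; _*_ to _⊗_; refl to ≈-refl; sym to ≈-sym; trans to ≈-trans)
  open RingSums R
  open import Relation.Binary.Reasoning.Setoid setoid

  -- Weight of the forest obtained by giving the trees s a new root u, smaller
  -- than every vertex of G ↭ s ++ r: the new root has |s| children and level
  -- |r| + 1, and every other vertex keeps its level.
  weight-attach : ∀ u s r G → G ↭ s ++ r → All IncreasingTree G → All (u <_) (labelsF G) →
    weight R φ (attach u (s , r)) ≈ φ (length s) (suc (length r)) ⊗ weight R φ G
  weight-attach u s r G G↭ G-inc G-above =
    *-cong (≡⇒≈ (≡.cong (φ (length s)) (level-minimum u s r s-above r-above))) others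
    where
    F : Forest
    F = attach u (s , r)
    above : All (u <_) (labelsF s ++ labelsF r)
    above = All-resp-↭ (↭-trans (labelsF-↭ G↭) (↭-reflexive (labelsF-++ s r))) G-above
    s-above : All (u <_) (labelsF s)
    s-above = All.++⁻ˡ (labelsF s) above
    r-above : All (u <_) (labelsF r)
    r-above = All.++⁻ʳ (labelsF s) above
    s-inc : All IncreasingTree s
    s-inc = All.tabulate (λ t∈s → All.lookup G-inc (∈-resp-↭ (↭-sym G↭) (∈-++⁺ˡ t∈s)))
    factorIn : Forest → ℕ × ℕ → Carrier
    factorIn H vc = φ (proj₂ vc) (level H (proj₁ vc))
    same-level : ∀ {vc} → vc ∈ vertsF (s ++ r) → factorIn F vc ≡ factorIn G vc
    same-level {v , _} vc∈ = ≡.cong (φ _) (≡.trans (level-below u s r v s-inc u<v) (level-↭ v (↭-sym G↭)))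
      where
      u<v : u < v
      u<v = All.lookup above (≡.subst (v ∈_) (labelsF-++ s r) (vertex∈labelsF (s ++ r) vc∈))
    others : prodR R (map (factorIn F) (vertsF s ++ vertsF r)) ≈ prodR R (map (factorIn G) (vertsF G))
    others = begin
      prodR R (map (factorIn F) (vertsF s ++ vertsF r)) ≡⟨ ≡.cong (prodR R ∘ map (factorIn F)) (vertsF-++ s r) ⟨
      prodR R (map (factorIn F) (vertsF (s ++ r)))      ≡⟨ ≡.cong (prodR R) (map-cong-local (All.tabulate same-level)) ⟩
      prodR R (map (factorIn G) (vertsF (s ++ r)))      ≈⟨ prod-↭ (↭.map⁺ (factorIn G) (vertsF-↭ (↭-sym G↭))) ⟩
      prodR R (map (factorIn G) (vertsF G))             ∎

  -- Factor contributed by a new root over the selection (s , r) when the new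
  -- forest is to have k trees and d children were chosen beforehand.
  rootFactor : ℕ → ℕ → List Tree × List Tree → Carrier
  rootFactor d k (s , r) = if suc (length r) ≡ᵇ k then φ (d + length s) k else 0#

  -- The total of rootFactor d k over all selections from j trees (see selections-sum):
  -- either no further child is chosen, or one of the j trees is chosen next.
  childSum : ℕ → ℕ → ℕ → Carrier
  childSum k zero d = (if 1 ≡ᵇ k then φ (d + 0) k else 0#) ⊕ 0#
  childSum k (suc j) d = (if suc (suc j) ≡ᵇ k then φ (d + 0) k else 0#) ⊕ fromℕ R (suc j) ⊗ childSum k j (suc d)

  selections-sum : ∀ n G d k → length G ≤ n → Σ (rootFactor d k) (selections n G) ≈ childSum k (length G) d
  selections-sum zero [] d k _ = ≈-refl
  selections-sum (suc n) [] d k _ = ≈-refl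
  selections-sum (suc n) G@(x ∷ xs) d k (s≤s |xs|≤n) = +-congˡ (begin
    Σ (rootFactor d k) (concatMap block (removals G))       ≈⟨ Σ-concatMap (rootFactor d k) block (removals G) ⟩
    Σ (λ p → Σ (rootFactor d k) (block p)) (removals G)     ≈⟨ Σ-const _ (removals G) _ block-sum ⟩
    fromℕ R (length (removals G)) ⊗ childSum k (length xs) (suc d)
      ≡⟨ ≡.cong (λ m → fromℕ R m ⊗ childSum k (length xs) (suc d)) (length-removals G) ⟩
    fromℕ R (suc (length xs)) ⊗ childSum k (length xs) (suc d) ∎)
    where
    block : Tree × List Tree → List (List Tree × List Tree)
    block (y , G′) = map (prepend y) (selections n G′)
    -- after removing the first child y, the remaining choices are selections from G′
    block-sum : ∀ {p} → p ∈ removals G → Σ (rootFactor d k) (block p) ≈ childSum k (length xs) (suc d)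
    block-sum {y , G′} rm = begin
      Σ (rootFactor d k) (map (prepend y) (selections n G′)) ≈⟨ Σ-map (rootFactor d k) (prepend y) (selections n G′) ⟩
      Σ (rootFactor d k ∘ prepend y) (selections n G′)       ≈⟨ Σ-cong (selections n G′) (λ {(s , r)} _ →
                                                                  ≡⇒≈ (≡.cong (λ m → if suc (length r) ≡ᵇ k then φ m k else 0#) (ℕ.+-suc d (length s)))) ⟩
      Σ (rootFactor (suc d) k) (selections n G′)              ≈⟨ selections-sum n G′ (suc d) k (≡.subst (_≤ n) (≡.sym |G′|≡) |xs|≤n) ⟩
      childSum k (length G′) (suc d)                          ≡⟨ ≡.cong (λ m → childSum k m (suc d)) |G′|≡ ⟩
      childSum k (length xs) (suc d)                          ∎
      where
      |G′|≡ : length G′ ≡ length xs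
      |G′|≡ = ℕ.suc-injective (≡.sym (↭.↭-length (removal-↭ rm)))

  drop-false-term : ∀ {b} x y → b ≡ false → (if b then x else 0#) ⊕ y ≈ y
  drop-false-term x y ≡.refl = +-identityˡ y

  childSum-zero : ∀ j d → childSum 0 j d ≈ 0#
  childSum-zero zero d = +-identityˡ 0#
  childSum-zero (suc j) d = ≈-trans (+-identityˡ _) (≈-trans (*-congˡ (childSum-zero j (suc d))) (zeroʳ _))

  childSum-above : ∀ κ j d → j < κ → childSum (suc κ) j d ≈ 0#
  childSum-above κ zero d 0<κ = drop-false-term _ 0# (reflects-false (≡ᵇ-reflects-≡ 1 (suc κ)) (λ 1≡ → ℕ.<-irrefl (≡.cong ℕ.pred 1≡) 0<κ))
  childSum-above κ (suc j) d j<κ =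
    ≈-trans (drop-false-term _ _ (reflects-false (≡ᵇ-reflects-≡ (suc (suc j)) (suc κ)) (λ eq → ℕ.<-irrefl (≡.cong ℕ.pred eq) j<κ)))
          (≈-trans (*-congˡ (childSum-above κ j (suc d) (ℕ.<-trans (ℕ.n<1+n j) j<κ))) (zeroʳ _))

  -- With κ + 1 trees in total, the new root takes j − κ of the j trees as an
  -- ordered selection: j!/κ! = j P′ (j − κ) choices.
  childSum-closed : ∀ κ j d → κ ≤ j → childSum (suc κ) j d ≈ fromℕ R (j P′ (j ∸ κ)) ⊗ φ (d + (j ∸ κ)) (suc κ)
  childSum-closed zero zero d _ = ≈-trans (+-identityʳ _) (≈-sym (≈-trans (*-congʳ fromℕ-1) (*-identityˡ _)))
  childSum-closed κ (suc i) d κ≤1+i with ℕ.m≤n⇒m<n∨m≡n κ≤1+i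
  ... | inj₂ ≡.refl rewrite reflects-true (≡ᵇ-reflects-≡ (suc (suc i)) (suc (suc i))) ≡.refl | ℕ.n∸n≡0 i = begin
    φ (d + 0) (suc (suc i)) ⊕ fromℕ R (suc i) ⊗ childSum (suc (suc i)) i (suc d)
      ≈⟨ +-congˡ (≈-trans (*-congˡ (childSum-above (suc i) i (suc d) (ℕ.n<1+n i))) (zeroʳ _)) ⟩
    φ (d + 0) (suc (suc i)) ⊕ 0#                ≈⟨ +-identityʳ _ ⟩
    φ (d + 0) (suc (suc i))                     ≈⟨ ≈-trans (*-congʳ fromℕ-1) (*-identityˡ _) ⟨
    fromℕ R 1 ⊗ φ (d + 0) (suc (suc i))         ∎
  ... | inj₁ (s≤s κ≤i) rewrite ℕ.+-∸-assoc 1 κ≤i = begin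
    (if suc (suc i) ≡ᵇ suc κ then φ (d + 0) (suc κ) else 0#) ⊕ fromℕ R (suc i) ⊗ childSum (suc κ) i (suc d)
      ≈⟨ drop-false-term _ _ (reflects-false (≡ᵇ-reflects-≡ (suc (suc i)) (suc κ)) (λ eq → ℕ.<-irrefl (≡.sym (≡.cong ℕ.pred eq)) (s≤s κ≤i))) ⟩
    fromℕ R (suc i) ⊗ childSum (suc κ) i (suc d)
      ≈⟨ *-congˡ (childSum-closed κ i (suc d) κ≤i) ⟩
    fromℕ R (suc i) ⊗ (fromℕ R (i P′ (i ∸ κ)) ⊗ φ (suc d + (i ∸ κ)) (suc κ))
      ≈⟨ *-assoc _ _ _ ⟨
    (fromℕ R (suc i) ⊗ fromℕ R (i P′ (i ∸ κ))) ⊗ φ (suc d + (i ∸ κ)) (suc κ)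
      ≈⟨ *-cong (≈-sym (fromℕ-* (suc i) (i P′ (i ∸ κ)))) (≡⇒≈ (≡.cong (λ m → φ m (suc κ)) (≡.sym (ℕ.+-suc d (i ∸ κ))))) ⟩
    fromℕ R (suc i ℕ.* (i P′ (i ∸ κ))) ⊗ φ (d + suc (i ∸ κ)) (suc κ)
      ≡⟨ ≡.cong (λ m → fromℕ R m ⊗ φ (d + suc (i ∸ κ)) (suc κ)) (≡.sym (nP′k≡n[n∸1P′k∸1] (suc i) (suc (i ∸ κ)))) ⟩
    fromℕ R (suc i P′ suc (i ∸ κ)) ⊗ φ (d + suc (i ∸ κ)) (suc κ) ∎

  childSum≈Pmat : ∀ j k → childSum k j 0 ≈ Pmat R φ j k
  childSum≈Pmat j zero = childSum-zero j 0
  childSum≈Pmat j (suc κ) with κ ≤ᵇ j in κ≤ᵇj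
  ... | true = ≈-trans (childSum-closed κ j 0 κ≤j) (≡⇒≈ (≡.cong (λ m → fromℕ R m ⊗ φ (j ∸ κ) (suc κ)) (≡.sym (P≡P′ (ℕ.m∸n≤m j κ)))))
    where
    κ≤j : κ ≤ j
    κ≤j = reflected (ℕ.≤ᵇ-reflects-≤ κ j) κ≤ᵇj
  ... | false = childSum-above κ j 0 (ℕ.≰⇒> (not-reflected (ℕ.≤ᵇ-reflects-≤ κ j) κ≤ᵇj))

valid⇒forestOn : ∀ {n k F} → ValidForest n k F → ForestOn 0 n F × length F ≡ k
valid⇒forestOn (|F|≡k , roots< , F-inc , F-labels) =
  (Linked.Linked⇒AllPairs ℕ.<-trans (Linked.map⁻ roots<) , F-inc , ≡.subst (_ ↭_) (upTo-suc≡range _) F-labels) , |F|≡k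

forestOn⇒valid : ∀ {n k F} → ForestOn 0 n F → length F ≡ k → ValidForest n k F
forestOn⇒valid (sorted , F-inc , F-labels) |F|≡k =
  |F|≡k , Linked.map⁺ (Linked.AllPairs⇒Linked sorted) , F-inc , ≡.subst (_ ↭_) (≡.sym (upTo-suc≡range _)) F-labels

hasTrees : ℕ → Forest → Bool
hasTrees k F = length F ≡ᵇ k

enumeration-↭ : ∀ {n k fs} → IsForestEnum n k fs → fs ↭ filterᵇ (hasTrees k) (forestsOn 0 n)
enumeration-↭ {n} {k} {fs} (valid , complete , fs-unique) =
  unique-same-members⇒↭ fs-unique (Unique.filter⁺ (T? ∘ hasTrees k) (forestsOn-unique 0 n)) to from
  where
  to : ∀ {F} → F ∈ fs → F ∈ filterᵇ (hasTrees k) (forestsOn 0 n)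
  to F∈ with valid⇒forestOn (valid _ F∈)
  ... | F-on , |F|≡k = ∈-filter⁺ (T? ∘ hasTrees k) (forestsOn-complete 0 n _ F-on) (ℕ.≡⇒≡ᵇ _ k |F|≡k)
  from : ∀ {F} → F ∈ filterᵇ (hasTrees k) (forestsOn 0 n) → F ∈ fs
  from F∈ with ∈-filter⁻ (T? ∘ hasTrees k) {xs = forestsOn 0 n} F∈
  ... | F∈forests , |F|≡ᵇk = complete _ (forestOn⇒valid (forestsOn-sound 0 n F∈forests) (ℕ.≡ᵇ⇒≡ _ k |F|≡ᵇk))

module ProductionMatrices {c ℓ : Level} (R : CommutativeRing c ℓ) (φ : ℕ → ℕ → CommutativeRing.Carrier R) where
  open CommutativeRing R renaming (_+_ to _⊕_; _*_ to _⊗_; refl to ≈-refl; sym to ≈-sym; trans to ≈-trans)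
  open RingSums R
  open Powers R
  open Weights R φ
  open import Relation.Binary.Reasoning.Setoid setoid

  weightIfTrees : ℕ → Forest → Carrier
  weightIfTrees k F = if hasTrees k F then weight R φ F else 0#

  Pmat-hessenberg : ∀ i j → suc (suc i) ≤ j → Pmat R φ i j ≈ 0#
  Pmat-hessenberg i (suc j) (s≤s i<j) rewrite reflects-false (ℕ.≤ᵇ-reflects-≤ j i) (ℕ.<⇒≱ i<j) = ≈-refl

  open Hessenberg (Pmat R φ) Pmat-hessenberg using (power-right)

  attachments-sum : ∀ {a n G} k → ForestOn (suc a) n G →
    Σ (weightIfTrees k ∘ attach (suc a)) (selections n G) ≈ Pmat R φ (length G) k ⊗ weight R φ G
  attachments-sum {a} {n} {G} k G-on@(_ , G-inc , G-labels) = begin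
    Σ (weightIfTrees k ∘ attach (suc a)) (selections n G) ≈⟨ Σ-cong (selections n G) term ⟩
    Σ (λ sel → rootFactor 0 k sel ⊗ weight R φ G) (selections n G) ≈⟨ Σ-*ʳ (rootFactor 0 k) (selections n G) _ ⟨
    Σ (rootFactor 0 k) (selections n G) ⊗ weight R φ G ≈⟨ *-congʳ (selections-sum n G 0 k (#trees≤n G-on)) ⟩
    childSum k (length G) 0 ⊗ weight R φ G ≈⟨ *-congʳ (childSum≈Pmat (length G) k) ⟩
    Pmat R φ (length G) k ⊗ weight R φ G ∎
    where
    term : ∀ {sel} → sel ∈ selections n G → weightIfTrees k (attach (suc a) sel) ≈ rootFactor 0 k sel ⊗ weight R φ G
    term {s , r} sel∈ with suc (length r) ≡ᵇ k in |F|≡ᵇk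
    ... | false = ≈-sym (zeroˡ _)
    ... | true rewrite ≡.sym (reflected (≡ᵇ-reflects-≡ (suc (length r)) k) |F|≡ᵇk) =
      weight-attach (suc a) s r G (↭-sym (selection-↭ n G sel∈)) G-inc
        (All.tabulate (range-above (suc a) n ∘ ∈-resp-↭ G-labels))

  single-column : ∀ {n} k G → length G ≤ n →
    Pmat R φ (length G) k ⊗ weight R φ G ≈ Σ< (suc n) (λ j → weightIfTrees j G ⊗ Pmat R φ j k)
  single-column {n} k G |G|≤n = begin
    Pmat R φ (length G) k ⊗ weight R φ G ≈⟨ *-comm _ _ ⟩
    weight R φ G ⊗ Pmat R φ (length G) k
      ≈⟨ Σ<-select (suc n) (length G) (λ j → weight R φ G ⊗ Pmat R φ j k) (s≤s |G|≤n) ⟨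
    Σ< (suc n) (λ j → if length G ≡ᵇ j then weight R φ G ⊗ Pmat R φ j k else 0#)
      ≈⟨ Σ<-cong (suc n) (λ j _ → if-*ʳ (length G ≡ᵇ j) (weight R φ G) (Pmat R φ j k)) ⟨
    Σ< (suc n) (λ j → weightIfTrees j G ⊗ Pmat R φ j k) ∎
    where
    if-*ʳ : ∀ b x y → (if b then x else 0#) ⊗ y ≈ (if b then x ⊗ y else 0#)
    if-*ʳ true _ _ = ≈-refl
    if-*ʳ false _ y = zeroˡ y

  -- Part (b), for forests on {a+1, …, a+n}: Σ_F weight(F) over forests with k
  -- trees is (Pⁿ)_{0k}. Deleting the minimal vertex gives the row recursion
  -- O(P)_{n+1,k} = Σ_j O(P)_{n,j} P_{jk}.
  forests-sum : ∀ n a k → Σ (weightIfTrees k) (forestsOn a n) ≈ output R (Pmat R φ) (hessBound R) n k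
  forests-sum zero a k = +-identityʳ _
  forests-sum (suc n) a k = begin
    Σ (weightIfTrees k) (concatMap block Gs)                        ≈⟨ Σ-concatMap (weightIfTrees k) block Gs ⟩
    Σ (λ G → Σ (weightIfTrees k) (block G)) Gs                      ≈⟨ Σ-cong Gs (λ {G} G∈ → ≈-trans (Σ-map (weightIfTrees k) (attach (suc a)) (selections n G)) (attachments-sum k (forestsOn-sound (suc a) n G∈))) ⟩
    Σ (λ G → Pmat R φ (length G) k ⊗ weight R φ G) Gs               ≈⟨ Σ-cong Gs (λ {G} G∈ → single-column k G (#trees≤n (forestsOn-sound (suc a) n G∈))) ⟩
    Σ (λ G → Σ< (suc n) (λ j → weightIfTrees j G ⊗ Pmat R φ j k)) Gs ≈⟨ Σ<-Σ (suc n) (λ j G → weightIfTrees j G ⊗ Pmat R φ j k) Gs ⟨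
    Σ< (suc n) (λ j → Σ (λ G → weightIfTrees j G ⊗ Pmat R φ j k) Gs) ≈⟨ Σ<-cong (suc n) (λ j _ → ≈-sym (Σ-*ʳ (weightIfTrees j) Gs (Pmat R φ j k))) ⟩
    Σ< (suc n) (λ j → Σ (weightIfTrees j) Gs ⊗ Pmat R φ j k)         ≈⟨ Σ<-cong (suc n) {λ j → Σ (weightIfTrees j) Gs ⊗ Pmat R φ j k} (λ j _ → *-congʳ (forests-sum n (suc a) j)) ⟩
    Σ< (suc n) (λ j → pow (Pmat R φ) n 0 j ⊗ Pmat R φ j k)          ≈⟨ power-right n 0 k ⟨
    output R (Pmat R φ) (hessBound R) (suc n) k                      ∎
    where
    Gs : List Forest
    Gs = forestsOn (suc a) n
    block : Forest → List Forest
    block G = map (attach (suc a)) (selections n G)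

  Pmat-produces-Lhat : ∀ {n k fs} → IsForestEnum n k fs → output R (Pmat R φ) (hessBound R) n k ≈ Lhat R φ fs
  Pmat-produces-Lhat {n} {k} {fs} enum = begin
    output R (Pmat R φ) (hessBound R) n k                  ≈⟨ forests-sum n 0 k ⟨
    Σ (weightIfTrees k) (forestsOn 0 n)                    ≈⟨ Σ-filter (weight R φ) (hasTrees k) (forestsOn 0 n) ⟨
    Σ (weight R φ) (filterᵇ (hasTrees k) (forestsOn 0 n))  ≈⟨ sum-↭ (↭.map⁺ (weight R φ) (enumeration-↭ enum)) ⟨
    Lhat R φ fs                                            ∎

P′*factorial : ∀ n k → k ≤ n → (n P′ k) * (n ∸ k) ! ≡ n !
P′*factorial n zero _ = ℕ.*-identityˡ (n !)
P′*factorial (suc n) (suc k) (s≤s k≤n) = begin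
  (suc n P′ suc k) * (n ∸ k) !   ≡⟨ ≡.cong (_* (n ∸ k) !) (nP′k≡n[n∸1P′k∸1] (suc n) (suc k)) ⟩
  suc n * (n P′ k) * (n ∸ k) !   ≡⟨ ℕ.*-assoc (suc n) (n P′ k) ((n ∸ k) !) ⟩
  suc n * ((n P′ k) * (n ∸ k) !) ≡⟨ ≡.cong (suc n *_) (P′*factorial n k k≤n) ⟩
  suc n * n !                    ∎
  where open ≡-Reasoning

falling-factorial : ∀ i κ → κ ≤ i → (i P (i ∸ κ)) * suc κ ! ≡ i ! * suc κ
falling-factorial i κ κ≤i = begin
  (i P (i ∸ κ)) * (suc κ * κ !)           ≡⟨ ≡.cong (λ m → m * (suc κ * κ !)) (P≡P′ (ℕ.m∸n≤m i κ)) ⟩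
  (i P′ (i ∸ κ)) * (suc κ * κ !)          ≡⟨ x∙yz≈y∙xz (i P′ (i ∸ κ)) (suc κ) (κ !) ⟩
  suc κ * ((i P′ (i ∸ κ)) * κ !)          ≡⟨ ≡.cong (λ m → suc κ * ((i P′ (i ∸ κ)) * m !)) (ℕ.m∸[m∸n]≡n κ≤i) ⟨
  suc κ * ((i P′ (i ∸ κ)) * (i ∸ (i ∸ κ)) !) ≡⟨ ≡.cong (suc κ *_) (P′*factorial i (i ∸ κ) (ℕ.m∸n≤m i κ)) ⟩
  suc κ * i !                             ≡⟨ ℕ.*-comm (suc κ) (i !) ⟩
  i ! * suc κ                             ∎
  where open ≡-Reasoning

applyUpTo-+ : ∀ {a} {A : Set a} (f : ℕ → A) m l → applyUpTo f (m + l) ≡ applyUpTo f m ++ applyUpTo (λ t → f (m + t)) l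
applyUpTo-+ f zero l = ≡.refl
applyUpTo-+ f (suc m) l = ≡.cong (f 0 ∷_) (applyUpTo-+ (λ t → f (suc t)) m l)

module Similarities {c ℓ : Level} (R : CommutativeRing c ℓ) (φ : ℕ → ℕ → CommutativeRing.Carrier R) where
  open CommutativeRing R renaming (_+_ to _⊕_; _*_ to _⊗_; refl to ≈-refl; sym to ≈-sym; trans to ≈-trans)
  open RingSums R
  open import Relation.Binary.Reasoning.Setoid setoid
  import Algebra.Properties.CommutativeSemigroup *-commutativeSemigroup as *-CS

  Pmat-Pord-similar : ∀ i j → Pmat R φ i j ⊗ fromℕ R (j !) ≈ fromℕ R (i !) ⊗ Pord R φ i j
  Pmat-Pord-similar i zero = ≈-trans (zeroˡ _) (≈-sym (zeroʳ _))
  Pmat-Pord-similar i (suc κ) with κ ≤ᵇ i in κ≤ᵇi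
  ... | false = ≈-trans (zeroˡ _) (≈-sym (zeroʳ _))
  ... | true = begin
    (fromℕ R (i P (i ∸ κ)) ⊗ φ′) ⊗ fromℕ R (suc κ !)   ≈⟨ *-CS.xy∙z≈xz∙y _ _ _ ⟩
    (fromℕ R (i P (i ∸ κ)) ⊗ fromℕ R (suc κ !)) ⊗ φ′   ≈⟨ *-congʳ (fromℕ-* (i P (i ∸ κ)) (suc κ !)) ⟨
    fromℕ R ((i P (i ∸ κ)) * suc κ !) ⊗ φ′              ≡⟨ ≡.cong (λ m → fromℕ R m ⊗ φ′) (falling-factorial i κ κ≤i) ⟩
    fromℕ R (i ! * suc κ) ⊗ φ′                          ≈⟨ *-congʳ (fromℕ-* (i !) (suc κ)) ⟩
    (fromℕ R (i !) ⊗ fromℕ R (suc κ)) ⊗ φ′              ≈⟨ *-assoc _ _ _ ⟩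
    fromℕ R (i !) ⊗ (fromℕ R (suc κ) ⊗ φ′)              ∎
    where
    φ′ : Carrier
    φ′ = φ (i ∸ κ) (suc κ)
    κ≤i : κ ≤ i
    κ≤i = reflected (ℕ.≤ᵇ-reflects-≤ κ i) κ≤ᵇi

  E : ℕ → Carrier
  E j = prodPhi0 R φ 1 j

  E-split : ∀ m l → E (m + l) ≈ E m ⊗ prodPhi0 R φ (suc m) l
  E-split m l = ≈-trans (≡⇒≈ (≡.cong (prodR R) (applyUpTo-+ (λ t → φ 0 (suc t)) m l)))
    (prod-++ (applyUpTo (λ t → φ 0 (suc t)) m) (applyUpTo (λ t → φ 0 (suc (m + t))) l))

  Ptil-Pmat-similar : ∀ i j → Ptil R φ i j ⊗ E j ≈ E i ⊗ Pmat R φ i j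
  Ptil-Pmat-similar i zero = ≈-trans (zeroˡ _) (≈-sym (zeroʳ _))
  Ptil-Pmat-similar i (suc κ) with ℕ.<-cmp κ i
  ... | tri< κ<i _ _ rewrite reflects-true (ℕ.<ᵇ-reflects-< κ i) κ<i | reflects-true (ℕ.≤ᵇ-reflects-≤ κ i) (ℕ.<⇒≤ κ<i) = begin
    ((A ⊗ between) ⊗ φ′) ⊗ E (suc κ)    ≈⟨ *-CS.xy∙z≈xz∙y _ _ _ ⟩
    ((A ⊗ between) ⊗ E (suc κ)) ⊗ φ′    ≈⟨ *-congʳ (*-CS.xy∙z≈zx∙y _ _ _) ⟩
    ((E (suc κ) ⊗ A) ⊗ between) ⊗ φ′    ≈⟨ *-congʳ (*-CS.xy∙z≈xz∙y _ _ _) ⟩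
    ((E (suc κ) ⊗ between) ⊗ A) ⊗ φ′    ≈⟨ *-congʳ (*-congʳ (E-split (suc κ) (i ∸ suc κ))) ⟨
    (E (suc κ + (i ∸ suc κ)) ⊗ A) ⊗ φ′  ≡⟨ ≡.cong (λ m → (E m ⊗ A) ⊗ φ′) (ℕ.m+[n∸m]≡n κ<i) ⟩
    (E i ⊗ A) ⊗ φ′                      ≈⟨ *-assoc _ _ _ ⟩
    E i ⊗ (A ⊗ φ′)                      ∎
    where
    A between φ′ : Carrier
    A = fromℕ R (i P (i ∸ κ))
    between = prodPhi0 R φ (suc (suc κ)) (i ∸ suc κ)
    φ′ = φ (i ∸ κ) (suc κ)
  ... | tri≈ _ ≡.refl _ rewrite reflects-false (ℕ.<ᵇ-reflects-< κ κ) (ℕ.<-irrefl ≡.refl)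
                              | reflects-true (≡ᵇ-reflects-≡ κ κ) ≡.refl | reflects-true (ℕ.≤ᵇ-reflects-≤ κ κ) ℕ.≤-refl | ℕ.n∸n≡0 κ = begin
    1# ⊗ E (suc κ)                      ≈⟨ *-identityˡ _ ⟩
    E (suc κ)                           ≡⟨ ≡.cong E (ℕ.+-comm 1 κ) ⟩
    E (κ + 1)                           ≈⟨ E-split κ 1 ⟩
    E κ ⊗ (φ 0 (suc κ + 0) ⊗ 1#)        ≈⟨ *-congˡ (≈-trans (*-identityʳ _) (≡⇒≈ (≡.cong (φ 0) (ℕ.+-identityʳ (suc κ))))) ⟩
    E κ ⊗ φ 0 (suc κ)                   ≈⟨ *-congˡ (≈-trans (*-congʳ fromℕ-1) (*-identityˡ _)) ⟨
    E κ ⊗ (fromℕ R 1 ⊗ φ 0 (suc κ))     ∎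
  ... | tri> _ _ i<κ rewrite reflects-false (ℕ.<ᵇ-reflects-< κ i) (ℕ.<⇒≯ i<κ)
                           | reflects-false (≡ᵇ-reflects-≡ κ i) (ℕ.>⇒≢ i<κ) | reflects-false (ℕ.≤ᵇ-reflects-≤ κ i) (ℕ.<⇒≱ i<κ) =
    ≈-trans (zeroˡ _) (≈-sym (zeroʳ _))

proposition3p2 : {c ℓ : Level} (R : CommutativeRing c ℓ)
    (φ : ℕ → ℕ → CommutativeRing.Carrier R) (n k : ℕ) (fs : List Forest) →
    IsForestEnum n k fs →
    (CommutativeRing._≈_ R (output R (Pord R φ) (hessBound R) n k)
       (CommutativeRing._*_ R (fromℕ R (k !)) (Lhat R φ fs)))
    × (CommutativeRing._≈_ R (output R (Pmat R φ) (hessBound R) n k) (Lhat R φ fs))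
    × (CommutativeRing._≈_ R
         (CommutativeRing._*_ R (output R (Ptil R φ) (hessBound R) n k) (prodPhi0 R φ 1 k))
         (Lhat R φ fs))
proposition3p2 R φ n k fs enum = part-a , part-b , part-c
  where
  open CommutativeRing R using (_≈_; setoid; *-congʳ; *-identityˡ; *-comm) renaming (_*_ to _⊗_; trans to ≈-trans)
  open import Relation.Binary.Reasoning.Setoid setoid
  open RingSums R using (fromℕ-1)
  open Powers R using (power-similar)
  open ProductionMatrices R φ using (Pmat-produces-Lhat)
  open Similarities R φ using (Pmat-Pord-similar; Ptil-Pmat-similar; E)
  part-b : output R (Pmat R φ) (hessBound R) n k ≈ Lhat R φ fs
  part-b = Pmat-produces-Lhat enum
  -- (a) P ⋅ diag(j!) = diag(i!) ⋅ P^ord, and 0! = 1.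
  part-a : output R (Pord R φ) (hessBound R) n k ≈ fromℕ R (k !) ⊗ Lhat R φ fs
  part-a = begin
    output R (Pord R φ) (hessBound R) n k                  ≈⟨ ≈-trans (*-congʳ fromℕ-1) (*-identityˡ _) ⟨
    fromℕ R (0 !) ⊗ output R (Pord R φ) (hessBound R) n k  ≈⟨ power-similar (Pmat R φ) (Pord R φ) (λ j → fromℕ R (j !)) Pmat-Pord-similar n 0 k ⟨
    output R (Pmat R φ) (hessBound R) n k ⊗ fromℕ R (k !)  ≈⟨ *-congʳ part-b ⟩
    Lhat R φ fs ⊗ fromℕ R (k !)                            ≈⟨ *-comm _ _ ⟩
    fromℕ R (k !) ⊗ Lhat R φ fs                            ∎
  -- (c) P̃ ⋅ diag(E j) = diag(E i) ⋅ P, and E 0 = 1.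
  part-c : output R (Ptil R φ) (hessBound R) n k ⊗ E k ≈ Lhat R φ fs
  part-c = ≈-trans (power-similar (Ptil R φ) (Pmat R φ) E Ptil-Pmat-similar n 0 k) (≈-trans (*-identityˡ _) part-b)
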